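{- For every $a\in\{4,5\}$ and all $b,c\in\{2,3,4,5,6,7\}$, the grid $(a,b,c)$ is optimal; that is, it has a vertex subset of size exactly $\lceil (ab+ac+bc)/3\rceil$ that percolates under the $3$-neighbour bootstrap percolation process.
   Context: For positive integers $a,b,c$, the grid $(a,b,c)$ is the graph $P_a\Box P_b\Box P_c$ with vertex set $[a]\times[b]\times[c]$, two vertices being adjacent iff they differ by exactly $1$ in exactly one coordinate and agree in the others. In the $3$-neighbour bootstrap percolation process, starting from $A_0\subseteq V(G)$, one sets $A_t = A_{t-1}\cup\{v : |N(v)\cap A_{t-1}|\ge 3\}$ for $t\ge1$; $A_0$ percolates if $\bigcup_t A_t = V(G)$. -}

module Defs where

open import Data.Nat using (ℕ; zero; suc; _+_; _*_; _≡ᵇ_; _≤ᵇ_)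
open import Data.Nat.DivMod using (_/_)
open import Data.Fin using (Fin; toℕ)
open import Data.Bool using (Bool; true; false; _∧_; _∨_; if_then_else_)
open import Data.List using (List; length; filter; cartesianProduct; map; allFin)
open import Data.Product using (_×_; _,_; ∃)
open import Relation.Binary.PropositionalEquality using (_≡_)
open import Data.Bool.Properties using (T?)

-- Vertex set [a] × [b] × [c] of the grid (a,b,c) = P_a □ P_b □ P_c
-- (coordinates 0-indexed via Fin).
Vertex : ℕ → ℕ → ℕ → Set
Vertex a b c = Fin a × Fin b × Fin c

allVertices : (a b c : ℕ) → List (Vertex a b c)
allVertices a b c = cartesianProduct (allFin a) (cartesianProduct (allFin b) (allFin c))

differBy1 : {n : ℕ} → Fin n → Fin n → Bool
differBy1 i j = (suc (toℕ i) ≡ᵇ toℕ j) ∨ (suc (toℕ j) ≡ᵇ toℕ i)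

sameFin : {n : ℕ} → Fin n → Fin n → Bool
sameFin i j = toℕ i ≡ᵇ toℕ j

adjacent : {a b c : ℕ} → Vertex a b c → Vertex a b c → Bool
adjacent (x₁ , y₁ , z₁) (x₂ , y₂ , z₂) =
  (differBy1 x₁ x₂ ∧ sameFin y₁ y₂ ∧ sameFin z₁ z₂) ∨
  (sameFin x₁ x₂ ∧ differBy1 y₁ y₂ ∧ sameFin z₁ z₂) ∨
  (sameFin x₁ x₂ ∧ sameFin y₁ y₂ ∧ differBy1 z₁ z₂)

VSet : ℕ → ℕ → ℕ → Set
VSet a b c = Vertex a b c → Bool

size : {a b c : ℕ} → VSet a b c → ℕ
size {a} {b} {c} S = length (filter (λ v → T? (S v)) (allVertices a b c))

nbrCount : {a b c : ℕ} → VSet a b c → Vertex a b c → ℕ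
nbrCount {a} {b} {c} S v =
  length (filter (λ u → T? (adjacent u v ∧ S u)) (allVertices a b c))

step : {a b c : ℕ} → VSet a b c → VSet a b c
step S v = S v ∨ (3 ≤ᵇ nbrCount S v)

bootstrap : {a b c : ℕ} → VSet a b c → ℕ → VSet a b c
bootstrap A₀ zero = A₀
bootstrap A₀ (suc t) = step (bootstrap A₀ t)

Percolates : {a b c : ℕ} → VSet a b c → Set
Percolates A₀ = ∀ v → ∃ λ t → bootstrap A₀ t v ≡ true

-- ⌈(ab+ac+bc)/3⌉
ceilBound : ℕ → ℕ → ℕ → ℕ
ceilBound a b c = (a * b + a * c + b * c + 2) / 3

Optimal : ℕ → ℕ → ℕ → Set
Optimal a b c = ∃ λ (A₀ : VSet a b c) → size A₀ ≡ ceilBound a b c × Percolates A₀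

{-# OPTIONS --safe #-}
module Submission where

-- A vertex set A₀ percolates as soon as the vertices can be ranked by natural
-- numbers so that A₀ is exactly the set of rank-0 vertices and every vertex of
-- positive rank has at least three neighbours of strictly smaller rank: by
-- induction on k, every vertex of rank at most k is infected at time k.  For
-- each of the 72 grids an explicit ranking with ⌈(ab+ac+bc)/3⌉ seeds is given,
-- and both conditions are decided by evaluation.

open import Defs
open import Data.Bool using (T; _∧_)
open import Data.Bool.Properties using (T?; T-≡; T-∧; T-∨)
open import Data.Fin using (Fin; zero; suc; toℕ; fromℕ<)
open import Data.Fin.Properties using (all?; toℕ-fromℕ<)
open import Data.List.Relation.Binary.Sublist.Propositional using (⊆-refl)
open import Data.List.Relation.Binary.Sublist.Propositional.Properties using (filter⁺; length-mono-≤)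
open import Data.Nat using (ℕ; zero; suc; _+_; _≤_; _<_; _≡ᵇ_; _<ᵇ_; s≤s; z<s)
open import Data.Nat.Properties using (_≟_; _≤?_; _<?_; <ᵇ⇒<; ≤⇒≤ᵇ; ≤-refl; ≤-trans; ≤-pred; n≤0⇒n≡0; m≤n⇒m<n∨m≡n; +-cancelˡ-≤; m≤n⇒∃[o]m+o≡n)
open import Data.Product using (_×_; _,_; Σ-syntax)
open import Data.Sum using (_⊎_; inj₁; inj₂)
open import Data.Vec using (Vec; []; _∷_; lookup)
open import Function using (Equivalence)
open import Relation.Binary.PropositionalEquality using (_≡_; refl; cong; subst; sym)
open import Relation.Nullary.Decidable using (Dec; _×-dec_; _→-dec_; map′; toWitness)

private variable a b c : ℕ

interval-offset : ∀ {m n k} → m ≤ n → n ≤ m + k → Σ[ j ∈ Fin (suc k) ] m + toℕ j ≡ n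
interval-offset {m} {k = k} m≤n n≤m+k with d , refl ← m≤n⇒∃[o]m+o≡n m≤n =
  fromℕ< (s≤s (+-cancelˡ-≤ m d k n≤m+k)) , cong (m +_) (toℕ-fromℕ< _)

infix 4 _⊆ᵛ_

_⊆ᵛ_ : VSet a b c → VSet a b c → Set
S ⊆ᵛ S′ = ∀ v → T (S v) → T (S′ v)

nbrCount-mono : {S S′ : VSet a b c} → S ⊆ᵛ S′ → ∀ v → nbrCount S v ≤ nbrCount S′ v
nbrCount-mono {a} {b} {c} {S} {S′} S⊆S′ v =
  length-mono-≤ (filter⁺ (λ u → T? (adjacent u v ∧ S u)) (λ u → T? (adjacent u v ∧ S′ u))
                         adjacent-in (⊆-refl {x = allVertices a b c}))
  where
  adjacent-in : ∀ {u u′} → u ≡ u′ → T (adjacent u v ∧ S u) → T (adjacent u′ v ∧ S′ u′)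
  adjacent-in {u} refl h =
    let adj , u∈S = Equivalence.to T-∧ h in Equivalence.from T-∧ (adj , S⊆S′ u u∈S)

step-inflationary : {S : VSet a b c} → S ⊆ᵛ step S
step-inflationary v v∈S = Equivalence.from T-∨ (inj₁ v∈S)

step-activates : {S : VSet a b c} (v : Vertex a b c) → 3 ≤ nbrCount S v → T (step S v)
step-activates v 3≤n = Equivalence.from T-∨ (inj₂ (≤⇒≤ᵇ 3≤n))

Ranking : ℕ → ℕ → ℕ → Set
Ranking a b c = Vertex a b c → ℕ

seeds : Ranking a b c → VSet a b c
seeds r v = r v ≡ᵇ 0

below : Ranking a b c → Vertex a b c → VSet a b c
below r v u = r u <ᵇ r v

IsRanking : Ranking a b c → Set
IsRanking r = ∀ v → 0 < r v → 3 ≤ nbrCount (below r v) v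

module _ {r : Ranking a b c} (ranked : IsRanking r) where

  active-by-rank : ∀ k v → r v ≤ k → T (bootstrap (seeds r) k v)
  active-by-rank zero v rv≤0 = subst (λ n → T (n ≡ᵇ 0)) (sym (n≤0⇒n≡0 rv≤0)) _
  active-by-rank (suc k) v rv≤1+k with m≤n⇒m<n∨m≡n rv≤1+k
  ... | inj₁ rv<1+k = step-inflationary v (active-by-rank k v (≤-pred rv<1+k))
  ... | inj₂ rv≡1+k =
    step-activates v (≤-trans (ranked v 0<rv) (nbrCount-mono below⊆active v))
    where
    0<rv : 0 < r v
    0<rv = subst (0 <_) (sym rv≡1+k) z<s

    below⊆active : below r v ⊆ᵛ bootstrap (seeds r) k
    below⊆active u ru<rv =
      active-by-rank k u (≤-pred (subst (r u <_) rv≡1+k (<ᵇ⇒< (r u) (r v) ru<rv)))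

  ranking⇒percolates : Percolates (seeds r)
  ranking⇒percolates v = r v , Equivalence.to T-≡ (active-by-rank (r v) v ≤-refl)

isRanking? : (r : Ranking a b c) → Dec (IsRanking r)
isRanking? r =
  map′ (λ ranked (x , y , z) → ranked x y z) (λ ranked x y z → ranked (x , y , z))
    (all? λ x → all? λ y → all? λ z →
      let v = x , y , z in 0 <? r v →-dec 3 ≤? nbrCount (below r v) v)

OptimalRanking : Ranking a b c → Set
OptimalRanking {a} {b} {c} r = size (seeds r) ≡ ceilBound a b c × IsRanking r

optimalRanking? : (r : Ranking a b c) → Dec (OptimalRanking r)
optimalRanking? r = size (seeds r) ≟ _ ×-dec isRanking? r

optimalRanking⇒optimal : {r : Ranking a b c} → OptimalRanking r → Optimal a b c
optimalRanking⇒optimal {r = r} (size≡bound , ranked) =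
  seeds r , size≡bound , ranking⇒percolates ranked

fromTable : Vec (Vec (Vec ℕ c) b) a → Ranking a b c
fromTable t (x , y , z) = lookup (lookup (lookup t x) y) z

rankTable : (a b c : ℕ) → Ranking a b c
rankTable 4 2 2 = fromTable
  ( ((0 ∷ 1 ∷ []) ∷ (4 ∷ 0 ∷ []) ∷ [])
  ∷ ((2 ∷ 0 ∷ []) ∷ (3 ∷ 2 ∷ []) ∷ [])
  ∷ ((1 ∷ 0 ∷ []) ∷ (0 ∷ 1 ∷ []) ∷ [])
  ∷ ((0 ∷ 1 ∷ []) ∷ (1 ∷ 0 ∷ []) ∷ [])
  ∷ [])

rankTable 4 2 3 = fromTable
  ( ((0 ∷ 0 ∷ 1 ∷ []) ∷ (7 ∷ 6 ∷ 0 ∷ []) ∷ [])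
  ∷ ((1 ∷ 2 ∷ 0 ∷ []) ∷ (0 ∷ 5 ∷ 6 ∷ []) ∷ [])
  ∷ ((0 ∷ 3 ∷ 8 ∷ []) ∷ (1 ∷ 4 ∷ 7 ∷ []) ∷ [])
  ∷ ((1 ∷ 0 ∷ 9 ∷ []) ∷ (0 ∷ 1 ∷ 0 ∷ []) ∷ [])
  ∷ [])

rankTable 4 2 4 = fromTable
  ( ((4 ∷ 3 ∷ 0 ∷ 1 ∷ []) ∷ (0 ∷ 0 ∷ 1 ∷ 0 ∷ []) ∷ [])
  ∷ ((0 ∷ 2 ∷ 1 ∷ 0 ∷ []) ∷ (4 ∷ 3 ∷ 4 ∷ 5 ∷ []) ∷ [])
  ∷ ((6 ∷ 1 ∷ 0 ∷ 7 ∷ []) ∷ (5 ∷ 0 ∷ 5 ∷ 6 ∷ []) ∷ [])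
  ∷ ((7 ∷ 0 ∷ 7 ∷ 8 ∷ []) ∷ (0 ∷ 1 ∷ 6 ∷ 0 ∷ []) ∷ [])
  ∷ [])

rankTable 4 2 5 = fromTable
  ( ((0 ∷ 1 ∷ 0 ∷ 1 ∷ 0 ∷ []) ∷ (1 ∷ 0 ∷ 1 ∷ 0 ∷ 9 ∷ []) ∷ [])
  ∷ ((5 ∷ 4 ∷ 3 ∷ 4 ∷ 7 ∷ []) ∷ (0 ∷ 1 ∷ 2 ∷ 3 ∷ 8 ∷ []) ∷ [])
  ∷ ((6 ∷ 5 ∷ 0 ∷ 5 ∷ 6 ∷ []) ∷ (7 ∷ 0 ∷ 1 ∷ 2 ∷ 0 ∷ []) ∷ [])
  ∷ ((0 ∷ 8 ∷ 7 ∷ 6 ∷ 0 ∷ []) ∷ (10 ∷ 9 ∷ 0 ∷ 0 ∷ 1 ∷ []) ∷ [])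
  ∷ [])

rankTable 4 2 6 = fromTable
  ( ((0 ∷ 12 ∷ 11 ∷ 10 ∷ 1 ∷ 0 ∷ []) ∷ (14 ∷ 13 ∷ 0 ∷ 9 ∷ 0 ∷ 1 ∷ []) ∷ [])
  ∷ ((12 ∷ 11 ∷ 10 ∷ 9 ∷ 0 ∷ 1 ∷ []) ∷ (13 ∷ 0 ∷ 7 ∷ 8 ∷ 1 ∷ 0 ∷ []) ∷ [])
  ∷ ((1 ∷ 0 ∷ 5 ∷ 4 ∷ 3 ∷ 4 ∷ []) ∷ (0 ∷ 1 ∷ 6 ∷ 0 ∷ 2 ∷ 5 ∷ []) ∷ [])
  ∷ ((0 ∷ 1 ∷ 0 ∷ 0 ∷ 1 ∷ 0 ∷ []) ∷ (9 ∷ 8 ∷ 7 ∷ 1 ∷ 0 ∷ 6 ∷ []) ∷ [])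
  ∷ [])

rankTable 4 2 7 = fromTable
  ( ((0 ∷ 4 ∷ 5 ∷ 6 ∷ 0 ∷ 10 ∷ 11 ∷ []) ∷ (1 ∷ 0 ∷ 4 ∷ 0 ∷ 6 ∷ 7 ∷ 0 ∷ []) ∷ [])
  ∷ ((4 ∷ 3 ∷ 0 ∷ 7 ∷ 8 ∷ 9 ∷ 0 ∷ []) ∷ (0 ∷ 2 ∷ 3 ∷ 4 ∷ 5 ∷ 0 ∷ 1 ∷ []) ∷ [])
  ∷ ((5 ∷ 0 ∷ 1 ∷ 8 ∷ 9 ∷ 10 ∷ 13 ∷ []) ∷ (6 ∷ 1 ∷ 0 ∷ 1 ∷ 0 ∷ 11 ∷ 12 ∷ []) ∷ [])
  ∷ ((0 ∷ 1 ∷ 2 ∷ 9 ∷ 10 ∷ 0 ∷ 14 ∷ []) ∷ (7 ∷ 0 ∷ 1 ∷ 0 ∷ 11 ∷ 12 ∷ 0 ∷ []) ∷ [])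
  ∷ [])

rankTable 4 3 2 = fromTable
  ( ((5 ∷ 0 ∷ []) ∷ (4 ∷ 0 ∷ []) ∷ (0 ∷ 6 ∷ []) ∷ [])
  ∷ ((0 ∷ 1 ∷ []) ∷ (3 ∷ 2 ∷ []) ∷ (4 ∷ 5 ∷ []) ∷ [])
  ∷ ((1 ∷ 0 ∷ []) ∷ (2 ∷ 1 ∷ []) ∷ (3 ∷ 0 ∷ []) ∷ [])
  ∷ ((0 ∷ 1 ∷ []) ∷ (1 ∷ 0 ∷ []) ∷ (0 ∷ 1 ∷ []) ∷ [])
  ∷ [])

rankTable 4 3 3 = fromTable
  ( ((0 ∷ 1 ∷ 0 ∷ []) ∷ (9 ∷ 8 ∷ 7 ∷ []) ∷ (10 ∷ 9 ∷ 0 ∷ []) ∷ [])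
  ∷ ((1 ∷ 0 ∷ 5 ∷ []) ∷ (4 ∷ 3 ∷ 6 ∷ []) ∷ (5 ∷ 0 ∷ 7 ∷ []) ∷ [])
  ∷ ((0 ∷ 3 ∷ 4 ∷ []) ∷ (1 ∷ 2 ∷ 0 ∷ []) ∷ (0 ∷ 1 ∷ 8 ∷ []) ∷ [])
  ∷ ((5 ∷ 4 ∷ 0 ∷ []) ∷ (0 ∷ 3 ∷ 4 ∷ []) ∷ (1 ∷ 0 ∷ 9 ∷ []) ∷ [])
  ∷ [])

rankTable 4 3 4 = fromTable
  ( ((12 ∷ 11 ∷ 0 ∷ 7 ∷ []) ∷ (0 ∷ 6 ∷ 5 ∷ 6 ∷ []) ∷ (1 ∷ 0 ∷ 1 ∷ 0 ∷ []) ∷ [])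
  ∷ ((11 ∷ 10 ∷ 1 ∷ 0 ∷ []) ∷ (8 ∷ 7 ∷ 4 ∷ 3 ∷ []) ∷ (0 ∷ 1 ∷ 0 ∷ 1 ∷ []) ∷ [])
  ∷ ((0 ∷ 9 ∷ 0 ∷ 1 ∷ []) ∷ (9 ∷ 8 ∷ 5 ∷ 2 ∷ []) ∷ (10 ∷ 7 ∷ 6 ∷ 0 ∷ []) ∷ [])
  ∷ ((13 ∷ 12 ∷ 11 ∷ 0 ∷ []) ∷ (0 ∷ 9 ∷ 10 ∷ 0 ∷ []) ∷ (11 ∷ 0 ∷ 11 ∷ 12 ∷ []) ∷ [])
  ∷ [])

rankTable 4 3 5 = fromTable
  ( ((1 ∷ 0 ∷ 1 ∷ 0 ∷ 7 ∷ []) ∷ (0 ∷ 3 ∷ 4 ∷ 5 ∷ 6 ∷ []) ∷ (11 ∷ 10 ∷ 9 ∷ 8 ∷ 0 ∷ []) ∷ [])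
  ∷ ((0 ∷ 1 ∷ 0 ∷ 1 ∷ 0 ∷ []) ∷ (1 ∷ 2 ∷ 3 ∷ 4 ∷ 5 ∷ []) ∷ (0 ∷ 0 ∷ 8 ∷ 7 ∷ 6 ∷ []) ∷ [])
  ∷ ((13 ∷ 12 ∷ 1 ∷ 2 ∷ 3 ∷ []) ∷ (12 ∷ 11 ∷ 0 ∷ 1 ∷ 0 ∷ []) ∷ (13 ∷ 10 ∷ 9 ∷ 0 ∷ 1 ∷ []) ∷ [])
  ∷ ((14 ∷ 13 ∷ 0 ∷ 17 ∷ 18 ∷ []) ∷ (0 ∷ 12 ∷ 13 ∷ 16 ∷ 17 ∷ []) ∷ (14 ∷ 0 ∷ 14 ∷ 15 ∷ 0 ∷ []) ∷ [])
  ∷ [])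

rankTable 4 3 6 = fromTable
  ( ((0 ∷ 7 ∷ 8 ∷ 9 ∷ 16 ∷ 17 ∷ []) ∷ (1 ∷ 0 ∷ 1 ∷ 0 ∷ 1 ∷ 0 ∷ []) ∷ (18 ∷ 17 ∷ 16 ∷ 15 ∷ 0 ∷ 1 ∷ []) ∷ [])
  ∷ ((5 ∷ 6 ∷ 7 ∷ 0 ∷ 15 ∷ 16 ∷ []) ∷ (0 ∷ 1 ∷ 0 ∷ 1 ∷ 2 ∷ 1 ∷ []) ∷ (17 ∷ 16 ∷ 15 ∷ 14 ∷ 3 ∷ 0 ∷ []) ∷ [])
  ∷ ((4 ∷ 0 ∷ 8 ∷ 9 ∷ 14 ∷ 15 ∷ []) ∷ (3 ∷ 2 ∷ 1 ∷ 10 ∷ 11 ∷ 0 ∷ []) ∷ (0 ∷ 3 ∷ 0 ∷ 13 ∷ 12 ∷ 13 ∷ []) ∷ [])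
  ∷ ((0 ∷ 10 ∷ 9 ∷ 0 ∷ 13 ∷ 0 ∷ []) ∷ (12 ∷ 11 ∷ 0 ∷ 11 ∷ 12 ∷ 13 ∷ []) ∷ (17 ∷ 16 ∷ 15 ∷ 14 ∷ 0 ∷ 14 ∷ []) ∷ [])
  ∷ [])

rankTable 4 3 7 = fromTable
  ( ((6 ∷ 0 ∷ 0 ∷ 9 ∷ 10 ∷ 17 ∷ 18 ∷ []) ∷ (0 ∷ 6 ∷ 7 ∷ 8 ∷ 9 ∷ 10 ∷ 0 ∷ []) ∷ (10 ∷ 9 ∷ 8 ∷ 0 ∷ 1 ∷ 0 ∷ 1 ∷ []) ∷ [])
  ∷ ((5 ∷ 4 ∷ 3 ∷ 0 ∷ 9 ∷ 16 ∷ 17 ∷ []) ∷ (2 ∷ 5 ∷ 6 ∷ 7 ∷ 8 ∷ 11 ∷ 12 ∷ []) ∷ (0 ∷ 6 ∷ 7 ∷ 8 ∷ 0 ∷ 1 ∷ 0 ∷ []) ∷ [])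
  ∷ ((0 ∷ 3 ∷ 2 ∷ 1 ∷ 0 ∷ 15 ∷ 0 ∷ []) ∷ (1 ∷ 0 ∷ 1 ∷ 0 ∷ 1 ∷ 14 ∷ 13 ∷ []) ∷ (2 ∷ 1 ∷ 0 ∷ 9 ∷ 10 ∷ 15 ∷ 16 ∷ []) ∷ [])
  ∷ ((5 ∷ 4 ∷ 0 ∷ 4 ∷ 5 ∷ 16 ∷ 17 ∷ []) ∷ (0 ∷ 1 ∷ 2 ∷ 3 ∷ 0 ∷ 15 ∷ 0 ∷ []) ∷ (3 ∷ 0 ∷ 3 ∷ 10 ∷ 11 ∷ 16 ∷ 17 ∷ []) ∷ [])
  ∷ [])

rankTable 4 4 2 = fromTable
  ( ((1 ∷ 0 ∷ []) ∷ (0 ∷ 5 ∷ []) ∷ (7 ∷ 6 ∷ []) ∷ (8 ∷ 0 ∷ []) ∷ [])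
  ∷ ((0 ∷ 1 ∷ []) ∷ (1 ∷ 4 ∷ []) ∷ (0 ∷ 5 ∷ []) ∷ (7 ∷ 6 ∷ []) ∷ [])
  ∷ ((1 ∷ 0 ∷ []) ∷ (2 ∷ 3 ∷ []) ∷ (1 ∷ 4 ∷ []) ∷ (0 ∷ 5 ∷ []) ∷ [])
  ∷ ((0 ∷ 1 ∷ []) ∷ (1 ∷ 0 ∷ []) ∷ (0 ∷ 1 ∷ []) ∷ (1 ∷ 0 ∷ []) ∷ [])
  ∷ [])

rankTable 4 4 3 = fromTable
  ( ((0 ∷ 8 ∷ 0 ∷ []) ∷ (10 ∷ 9 ∷ 10 ∷ []) ∷ (11 ∷ 0 ∷ 1 ∷ []) ∷ (12 ∷ 1 ∷ 0 ∷ []) ∷ [])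
  ∷ ((6 ∷ 7 ∷ 12 ∷ []) ∷ (0 ∷ 4 ∷ 11 ∷ []) ∷ (2 ∷ 1 ∷ 0 ∷ []) ∷ (3 ∷ 0 ∷ 1 ∷ []) ∷ [])
  ∷ ((5 ∷ 0 ∷ 13 ∷ []) ∷ (4 ∷ 3 ∷ 12 ∷ []) ∷ (0 ∷ 2 ∷ 3 ∷ []) ∷ (1 ∷ 0 ∷ 2 ∷ []) ∷ [])
  ∷ ((0 ∷ 1 ∷ 14 ∷ []) ∷ (5 ∷ 0 ∷ 13 ∷ []) ∷ (4 ∷ 3 ∷ 4 ∷ []) ∷ (0 ∷ 1 ∷ 0 ∷ []) ∷ [])
  ∷ [])

rankTable 4 4 4 = fromTable
  ( ((21 ∷ 0 ∷ 1 ∷ 0 ∷ []) ∷ (20 ∷ 15 ∷ 0 ∷ 9 ∷ []) ∷ (15 ∷ 14 ∷ 11 ∷ 10 ∷ []) ∷ (0 ∷ 13 ∷ 12 ∷ 0 ∷ []) ∷ [])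
  ∷ ((20 ∷ 19 ∷ 20 ∷ 21 ∷ []) ∷ (19 ∷ 16 ∷ 7 ∷ 8 ∷ []) ∷ (0 ∷ 7 ∷ 6 ∷ 0 ∷ []) ∷ (1 ∷ 0 ∷ 5 ∷ 4 ∷ []) ∷ [])
  ∷ ((0 ∷ 18 ∷ 21 ∷ 22 ∷ []) ∷ (18 ∷ 17 ∷ 0 ∷ 3 ∷ []) ∷ (19 ∷ 18 ∷ 1 ∷ 2 ∷ []) ∷ (20 ∷ 19 ∷ 0 ∷ 3 ∷ []) ∷ [])
  ∷ ((1 ∷ 0 ∷ 22 ∷ 23 ∷ []) ∷ (0 ∷ 2 ∷ 1 ∷ 0 ∷ []) ∷ (20 ∷ 19 ∷ 0 ∷ 1 ∷ []) ∷ (21 ∷ 20 ∷ 1 ∷ 0 ∷ []) ∷ [])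
  ∷ [])

rankTable 4 4 5 = fromTable
  ( ((14 ∷ 0 ∷ 14 ∷ 15 ∷ 16 ∷ []) ∷ (13 ∷ 12 ∷ 13 ∷ 14 ∷ 15 ∷ []) ∷ (8 ∷ 7 ∷ 0 ∷ 1 ∷ 0 ∷ []) ∷ (0 ∷ 6 ∷ 5 ∷ 0 ∷ 1 ∷ []) ∷ [])
  ∷ ((0 ∷ 1 ∷ 13 ∷ 14 ∷ 0 ∷ []) ∷ (12 ∷ 11 ∷ 12 ∷ 13 ∷ 14 ∷ []) ∷ (0 ∷ 4 ∷ 3 ∷ 2 ∷ 3 ∷ []) ∷ (1 ∷ 0 ∷ 4 ∷ 1 ∷ 0 ∷ []) ∷ [])
  ∷ ((1 ∷ 0 ∷ 12 ∷ 15 ∷ 16 ∷ []) ∷ (13 ∷ 10 ∷ 11 ∷ 12 ∷ 15 ∷ []) ∷ (14 ∷ 7 ∷ 0 ∷ 1 ∷ 4 ∷ []) ∷ (15 ∷ 6 ∷ 5 ∷ 0 ∷ 1 ∷ []) ∷ [])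
  ∷ ((0 ∷ 1 ∷ 0 ∷ 16 ∷ 17 ∷ []) ∷ (14 ∷ 9 ∷ 8 ∷ 0 ∷ 16 ∷ []) ∷ (15 ∷ 8 ∷ 7 ∷ 0 ∷ 5 ∷ []) ∷ (16 ∷ 0 ∷ 6 ∷ 1 ∷ 0 ∷ []) ∷ [])
  ∷ [])

rankTable 4 4 6 = fromTable
  ( ((0 ∷ 8 ∷ 7 ∷ 6 ∷ 0 ∷ 1 ∷ []) ∷ (12 ∷ 9 ∷ 0 ∷ 5 ∷ 4 ∷ 0 ∷ []) ∷ (13 ∷ 10 ∷ 7 ∷ 6 ∷ 7 ∷ 8 ∷ []) ∷ (14 ∷ 11 ∷ 8 ∷ 0 ∷ 8 ∷ 9 ∷ []) ∷ [])
  ∷ ((12 ∷ 5 ∷ 4 ∷ 0 ∷ 1 ∷ 0 ∷ []) ∷ (11 ∷ 0 ∷ 1 ∷ 2 ∷ 3 ∷ 4 ∷ []) ∷ (10 ∷ 1 ∷ 0 ∷ 3 ∷ 0 ∷ 5 ∷ []) ∷ (0 ∷ 0 ∷ 5 ∷ 4 ∷ 1 ∷ 0 ∷ []) ∷ [])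
  ∷ ((13 ∷ 0 ∷ 3 ∷ 4 ∷ 7 ∷ 8 ∷ []) ∷ (10 ∷ 3 ∷ 2 ∷ 0 ∷ 6 ∷ 7 ∷ []) ∷ (9 ∷ 4 ∷ 3 ∷ 4 ∷ 5 ∷ 8 ∷ []) ∷ (8 ∷ 7 ∷ 6 ∷ 5 ∷ 0 ∷ 9 ∷ []) ∷ [])
  ∷ ((14 ∷ 5 ∷ 0 ∷ 5 ∷ 8 ∷ 9 ∷ []) ∷ (0 ∷ 4 ∷ 1 ∷ 0 ∷ 7 ∷ 0 ∷ []) ∷ (6 ∷ 5 ∷ 0 ∷ 5 ∷ 8 ∷ 9 ∷ []) ∷ (0 ∷ 8 ∷ 9 ∷ 10 ∷ 11 ∷ 12 ∷ []) ∷ [])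
  ∷ [])

rankTable 4 4 7 = fromTable
  ( ((29 ∷ 28 ∷ 0 ∷ 6 ∷ 7 ∷ 8 ∷ 0 ∷ []) ∷ (28 ∷ 27 ∷ 12 ∷ 0 ∷ 4 ∷ 0 ∷ 10 ∷ []) ∷ (0 ∷ 26 ∷ 11 ∷ 6 ∷ 5 ∷ 6 ∷ 11 ∷ []) ∷ (28 ∷ 27 ∷ 0 ∷ 7 ∷ 0 ∷ 13 ∷ 14 ∷ []) ∷ [])
  ∷ ((0 ∷ 23 ∷ 14 ∷ 5 ∷ 0 ∷ 9 ∷ 10 ∷ []) ∷ (27 ∷ 24 ∷ 13 ∷ 4 ∷ 3 ∷ 4 ∷ 9 ∷ []) ∷ (26 ∷ 25 ∷ 10 ∷ 5 ∷ 0 ∷ 5 ∷ 0 ∷ []) ∷ (0 ∷ 26 ∷ 9 ∷ 8 ∷ 9 ∷ 12 ∷ 13 ∷ []) ∷ [])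
  ∷ ((29 ∷ 22 ∷ 15 ∷ 0 ∷ 1 ∷ 10 ∷ 11 ∷ []) ∷ (28 ∷ 21 ∷ 14 ∷ 3 ∷ 2 ∷ 0 ∷ 8 ∷ []) ∷ (27 ∷ 0 ∷ 1 ∷ 0 ∷ 1 ∷ 6 ∷ 7 ∷ []) ∷ (28 ∷ 27 ∷ 0 ∷ 1 ∷ 10 ∷ 11 ∷ 0 ∷ []) ∷ [])
  ∷ ((30 ∷ 0 ∷ 16 ∷ 5 ∷ 0 ∷ 11 ∷ 12 ∷ []) ∷ (29 ∷ 20 ∷ 17 ∷ 4 ∷ 3 ∷ 4 ∷ 0 ∷ []) ∷ (0 ∷ 19 ∷ 18 ∷ 1 ∷ 0 ∷ 7 ∷ 8 ∷ []) ∷ (29 ∷ 28 ∷ 19 ∷ 0 ∷ 11 ∷ 12 ∷ 13 ∷ []) ∷ [])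
  ∷ [])

rankTable 4 5 2 = fromTable
  ( ((1 ∷ 0 ∷ []) ∷ (0 ∷ 1 ∷ []) ∷ (7 ∷ 0 ∷ []) ∷ (8 ∷ 1 ∷ []) ∷ (9 ∷ 0 ∷ []) ∷ [])
  ∷ ((0 ∷ 1 ∷ []) ∷ (3 ∷ 2 ∷ []) ∷ (6 ∷ 3 ∷ []) ∷ (7 ∷ 0 ∷ []) ∷ (8 ∷ 1 ∷ []) ∷ [])
  ∷ ((1 ∷ 0 ∷ []) ∷ (4 ∷ 0 ∷ []) ∷ (5 ∷ 4 ∷ []) ∷ (6 ∷ 1 ∷ []) ∷ (7 ∷ 0 ∷ []) ∷ [])
  ∷ ((0 ∷ 7 ∷ []) ∷ (5 ∷ 6 ∷ []) ∷ (0 ∷ 5 ∷ []) ∷ (1 ∷ 0 ∷ []) ∷ (0 ∷ 1 ∷ []) ∷ [])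
  ∷ [])

rankTable 4 5 3 = fromTable
  ( ((0 ∷ 1 ∷ 0 ∷ []) ∷ (1 ∷ 2 ∷ 3 ∷ []) ∷ (0 ∷ 3 ∷ 0 ∷ []) ∷ (13 ∷ 14 ∷ 15 ∷ []) ∷ (0 ∷ 15 ∷ 16 ∷ []) ∷ [])
  ∷ ((1 ∷ 0 ∷ 1 ∷ []) ∷ (0 ∷ 1 ∷ 4 ∷ []) ∷ (7 ∷ 6 ∷ 5 ∷ []) ∷ (12 ∷ 11 ∷ 0 ∷ []) ∷ (13 ∷ 14 ∷ 15 ∷ []) ∷ [])
  ∷ ((2 ∷ 1 ∷ 0 ∷ []) ∷ (3 ∷ 0 ∷ 5 ∷ []) ∷ (8 ∷ 7 ∷ 8 ∷ []) ∷ (9 ∷ 10 ∷ 11 ∷ []) ∷ (0 ∷ 0 ∷ 12 ∷ []) ∷ [])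
  ∷ ((0 ∷ 12 ∷ 15 ∷ []) ∷ (10 ∷ 11 ∷ 14 ∷ []) ∷ (9 ∷ 0 ∷ 13 ∷ []) ∷ (0 ∷ 11 ∷ 12 ∷ []) ∷ (13 ∷ 12 ∷ 0 ∷ []) ∷ [])
  ∷ [])

rankTable 4 5 4 = fromTable
  ( ((19 ∷ 16 ∷ 15 ∷ 0 ∷ []) ∷ (18 ∷ 15 ∷ 14 ∷ 1 ∷ []) ∷ (15 ∷ 14 ∷ 13 ∷ 0 ∷ []) ∷ (4 ∷ 0 ∷ 12 ∷ 11 ∷ []) ∷ (0 ∷ 1 ∷ 13 ∷ 0 ∷ []) ∷ [])
  ∷ ((18 ∷ 0 ∷ 12 ∷ 13 ∷ []) ∷ (17 ∷ 12 ∷ 11 ∷ 0 ∷ []) ∷ (0 ∷ 3 ∷ 0 ∷ 1 ∷ []) ∷ (3 ∷ 2 ∷ 3 ∷ 10 ∷ []) ∷ (4 ∷ 0 ∷ 14 ∷ 15 ∷ []) ∷ [])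
  ∷ ((17 ∷ 14 ∷ 0 ∷ 14 ∷ []) ∷ (16 ∷ 13 ∷ 10 ∷ 9 ∷ []) ∷ (1 ∷ 4 ∷ 5 ∷ 8 ∷ []) ∷ (0 ∷ 1 ∷ 0 ∷ 9 ∷ []) ∷ (19 ∷ 18 ∷ 17 ∷ 16 ∷ []) ∷ [])
  ∷ ((0 ∷ 15 ∷ 16 ∷ 17 ∷ []) ∷ (15 ∷ 14 ∷ 11 ∷ 0 ∷ []) ∷ (0 ∷ 5 ∷ 6 ∷ 7 ∷ []) ∷ (1 ∷ 0 ∷ 1 ∷ 0 ∷ []) ∷ (20 ∷ 19 ∷ 18 ∷ 0 ∷ []) ∷ [])
  ∷ [])

rankTable 4 5 5 = fromTable
  ( ((0 ∷ 20 ∷ 19 ∷ 18 ∷ 0 ∷ []) ∷ (14 ∷ 15 ∷ 16 ∷ 17 ∷ 18 ∷ []) ∷ (13 ∷ 0 ∷ 1 ∷ 0 ∷ 19 ∷ []) ∷ (12 ∷ 1 ∷ 0 ∷ 9 ∷ 20 ∷ []) ∷ (0 ∷ 10 ∷ 11 ∷ 12 ∷ 21 ∷ []) ∷ [])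
  ∷ ((22 ∷ 21 ∷ 18 ∷ 17 ∷ 16 ∷ []) ∷ (13 ∷ 4 ∷ 0 ∷ 12 ∷ 15 ∷ []) ∷ (12 ∷ 3 ∷ 2 ∷ 9 ∷ 14 ∷ []) ∷ (11 ∷ 0 ∷ 1 ∷ 8 ∷ 9 ∷ []) ∷ (10 ∷ 9 ∷ 0 ∷ 1 ∷ 0 ∷ []) ∷ [])
  ∷ ((23 ∷ 22 ∷ 0 ∷ 1 ∷ 0 ∷ []) ∷ (1 ∷ 0 ∷ 1 ∷ 11 ∷ 12 ∷ []) ∷ (0 ∷ 4 ∷ 5 ∷ 10 ∷ 13 ∷ []) ∷ (8 ∷ 7 ∷ 6 ∷ 7 ∷ 0 ∷ []) ∷ (0 ∷ 8 ∷ 7 ∷ 0 ∷ 1 ∷ []) ∷ [])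
  ∷ ((24 ∷ 23 ∷ 16 ∷ 0 ∷ 1 ∷ []) ∷ (0 ∷ 16 ∷ 15 ∷ 12 ∷ 0 ∷ []) ∷ (18 ∷ 17 ∷ 14 ∷ 13 ∷ 14 ∷ []) ∷ (19 ∷ 18 ∷ 0 ∷ 8 ∷ 15 ∷ []) ∷ (20 ∷ 19 ∷ 8 ∷ 0 ∷ 16 ∷ []) ∷ [])
  ∷ [])

rankTable 4 5 6 = fromTable
  ( ((18 ∷ 11 ∷ 0 ∷ 1 ∷ 4 ∷ 5 ∷ []) ∷ (17 ∷ 10 ∷ 3 ∷ 0 ∷ 3 ∷ 0 ∷ []) ∷ (0 ∷ 9 ∷ 8 ∷ 9 ∷ 10 ∷ 11 ∷ []) ∷ (1 ∷ 0 ∷ 7 ∷ 10 ∷ 11 ∷ 12 ∷ []) ∷ (0 ∷ 1 ∷ 0 ∷ 21 ∷ 22 ∷ 23 ∷ []) ∷ [])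
  ∷ ((0 ∷ 4 ∷ 3 ∷ 0 ∷ 3 ∷ 0 ∷ []) ∷ (16 ∷ 0 ∷ 2 ∷ 1 ∷ 2 ∷ 1 ∷ []) ∷ (15 ∷ 10 ∷ 3 ∷ 0 ∷ 1 ∷ 0 ∷ []) ∷ (14 ∷ 11 ∷ 6 ∷ 5 ∷ 0 ∷ 1 ∷ []) ∷ (15 ∷ 16 ∷ 17 ∷ 20 ∷ 21 ∷ 22 ∷ []) ∷ [])
  ∷ ((18 ∷ 9 ∷ 8 ∷ 7 ∷ 6 ∷ 7 ∷ []) ∷ (17 ∷ 10 ∷ 0 ∷ 2 ∷ 5 ∷ 6 ∷ []) ∷ (16 ∷ 11 ∷ 1 ∷ 3 ∷ 4 ∷ 5 ∷ []) ∷ (13 ∷ 12 ∷ 0 ∷ 4 ∷ 1 ∷ 0 ∷ []) ∷ (0 ∷ 17 ∷ 18 ∷ 19 ∷ 0 ∷ 1 ∷ []) ∷ [])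
  ∷ ((19 ∷ 0 ∷ 9 ∷ 8 ∷ 0 ∷ 20 ∷ []) ∷ (18 ∷ 11 ∷ 1 ∷ 0 ∷ 6 ∷ 19 ∷ []) ∷ (17 ∷ 12 ∷ 0 ∷ 4 ∷ 7 ∷ 18 ∷ []) ∷ (0 ∷ 13 ∷ 14 ∷ 15 ∷ 16 ∷ 17 ∷ []) ∷ (23 ∷ 22 ∷ 21 ∷ 20 ∷ 17 ∷ 0 ∷ []) ∷ [])
  ∷ [])

rankTable 4 5 7 = fromTable
  ( ((47 ∷ 46 ∷ 0 ∷ 18 ∷ 19 ∷ 20 ∷ 21 ∷ []) ∷ (46 ∷ 45 ∷ 1 ∷ 0 ∷ 10 ∷ 11 ∷ 0 ∷ []) ∷ (45 ∷ 44 ∷ 9 ∷ 8 ∷ 0 ∷ 12 ∷ 13 ∷ []) ∷ (44 ∷ 43 ∷ 18 ∷ 17 ∷ 16 ∷ 15 ∷ 14 ∷ []) ∷ (0 ∷ 42 ∷ 41 ∷ 40 ∷ 39 ∷ 38 ∷ 0 ∷ []) ∷ [])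
  ∷ ((0 ∷ 17 ∷ 16 ∷ 17 ∷ 0 ∷ 11 ∷ 0 ∷ []) ∷ (27 ∷ 18 ∷ 0 ∷ 8 ∷ 9 ∷ 10 ∷ 2 ∷ []) ∷ (28 ∷ 0 ∷ 8 ∷ 7 ∷ 2 ∷ 0 ∷ 1 ∷ []) ∷ (29 ∷ 24 ∷ 9 ∷ 6 ∷ 5 ∷ 4 ∷ 0 ∷ []) ∷ (30 ∷ 31 ∷ 32 ∷ 0 ∷ 36 ∷ 37 ∷ 38 ∷ []) ∷ [])
  ∷ ((27 ∷ 0 ∷ 15 ∷ 16 ∷ 13 ∷ 12 ∷ 13 ∷ []) ∷ (26 ∷ 19 ∷ 14 ∷ 13 ∷ 12 ∷ 11 ∷ 3 ∷ []) ∷ (25 ∷ 20 ∷ 9 ∷ 0 ∷ 1 ∷ 2 ∷ 0 ∷ []) ∷ (24 ∷ 23 ∷ 0 ∷ 1 ∷ 0 ∷ 3 ∷ 4 ∷ []) ∷ (0 ∷ 24 ∷ 33 ∷ 34 ∷ 35 ∷ 0 ∷ 39 ∷ []) ∷ [])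
  ∷ ((28 ∷ 21 ∷ 0 ∷ 17 ∷ 14 ∷ 0 ∷ 14 ∷ []) ∷ (0 ∷ 20 ∷ 19 ∷ 18 ∷ 13 ∷ 12 ∷ 0 ∷ []) ∷ (22 ∷ 21 ∷ 20 ∷ 19 ∷ 0 ∷ 13 ∷ 14 ∷ []) ∷ (0 ∷ 22 ∷ 23 ∷ 24 ∷ 25 ∷ 26 ∷ 27 ∷ []) ∷ (1 ∷ 0 ∷ 34 ∷ 35 ∷ 36 ∷ 37 ∷ 40 ∷ []) ∷ [])
  ∷ [])

rankTable 4 6 2 = fromTable
  ( ((11 ∷ 0 ∷ []) ∷ (0 ∷ 1 ∷ []) ∷ (5 ∷ 6 ∷ []) ∷ (0 ∷ 7 ∷ []) ∷ (9 ∷ 8 ∷ []) ∷ (10 ∷ 0 ∷ []) ∷ [])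
  ∷ ((10 ∷ 9 ∷ []) ∷ (1 ∷ 0 ∷ []) ∷ (4 ∷ 5 ∷ []) ∷ (1 ∷ 0 ∷ []) ∷ (0 ∷ 5 ∷ []) ∷ (7 ∷ 6 ∷ []) ∷ [])
  ∷ ((0 ∷ 8 ∷ []) ∷ (0 ∷ 7 ∷ []) ∷ (3 ∷ 6 ∷ []) ∷ (2 ∷ 3 ∷ []) ∷ (1 ∷ 4 ∷ []) ∷ (0 ∷ 5 ∷ []) ∷ [])
  ∷ ((10 ∷ 0 ∷ []) ∷ (9 ∷ 8 ∷ []) ∷ (0 ∷ 7 ∷ []) ∷ (1 ∷ 0 ∷ []) ∷ (0 ∷ 1 ∷ []) ∷ (1 ∷ 0 ∷ []) ∷ [])
  ∷ [])

rankTable 4 6 3 = fromTable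
  ( ((1 ∷ 0 ∷ 9 ∷ []) ∷ (0 ∷ 1 ∷ 8 ∷ []) ∷ (1 ∷ 0 ∷ 7 ∷ []) ∷ (0 ∷ 1 ∷ 6 ∷ []) ∷ (11 ∷ 0 ∷ 1 ∷ []) ∷ (12 ∷ 1 ∷ 0 ∷ []) ∷ [])
  ∷ ((0 ∷ 1 ∷ 0 ∷ []) ∷ (5 ∷ 4 ∷ 7 ∷ []) ∷ (6 ∷ 3 ∷ 6 ∷ []) ∷ (7 ∷ 2 ∷ 5 ∷ []) ∷ (10 ∷ 1 ∷ 0 ∷ []) ∷ (11 ∷ 0 ∷ 1 ∷ []) ∷ [])
  ∷ ((7 ∷ 6 ∷ 9 ∷ []) ∷ (6 ∷ 5 ∷ 8 ∷ []) ∷ (7 ∷ 1 ∷ 0 ∷ []) ∷ (8 ∷ 0 ∷ 4 ∷ []) ∷ (9 ∷ 2 ∷ 3 ∷ []) ∷ (0 ∷ 1 ∷ 4 ∷ []) ∷ [])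
  ∷ ((8 ∷ 0 ∷ 10 ∷ []) ∷ (0 ∷ 1 ∷ 9 ∷ []) ∷ (8 ∷ 0 ∷ 6 ∷ []) ∷ (9 ∷ 4 ∷ 5 ∷ []) ∷ (10 ∷ 3 ∷ 0 ∷ []) ∷ (11 ∷ 0 ∷ 5 ∷ []) ∷ [])
  ∷ [])

rankTable 4 6 4 = fromTable
  ( ((0 ∷ 21 ∷ 20 ∷ 0 ∷ []) ∷ (1 ∷ 0 ∷ 19 ∷ 20 ∷ []) ∷ (0 ∷ 1 ∷ 18 ∷ 21 ∷ []) ∷ (17 ∷ 16 ∷ 17 ∷ 22 ∷ []) ∷ (18 ∷ 15 ∷ 0 ∷ 23 ∷ []) ∷ (19 ∷ 0 ∷ 19 ∷ 24 ∷ []) ∷ [])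
  ∷ ((23 ∷ 22 ∷ 0 ∷ 1 ∷ []) ∷ (4 ∷ 1 ∷ 2 ∷ 0 ∷ []) ∷ (3 ∷ 0 ∷ 3 ∷ 8 ∷ []) ∷ (12 ∷ 11 ∷ 10 ∷ 9 ∷ []) ∷ (17 ∷ 14 ∷ 11 ∷ 0 ∷ []) ∷ (18 ∷ 15 ∷ 18 ∷ 19 ∷ []) ∷ [])
  ∷ ((24 ∷ 23 ∷ 24 ∷ 25 ∷ []) ∷ (5 ∷ 0 ∷ 3 ∷ 4 ∷ []) ∷ (2 ∷ 1 ∷ 0 ∷ 7 ∷ []) ∷ (0 ∷ 2 ∷ 7 ∷ 8 ∷ []) ∷ (16 ∷ 13 ∷ 12 ∷ 9 ∷ []) ∷ (17 ∷ 0 ∷ 17 ∷ 18 ∷ []) ∷ [])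
  ∷ ((25 ∷ 0 ∷ 25 ∷ 26 ∷ []) ∷ (6 ∷ 3 ∷ 4 ∷ 0 ∷ []) ∷ (0 ∷ 2 ∷ 5 ∷ 6 ∷ []) ∷ (1 ∷ 0 ∷ 6 ∷ 0 ∷ []) ∷ (15 ∷ 14 ∷ 13 ∷ 0 ∷ []) ∷ (0 ∷ 15 ∷ 16 ∷ 0 ∷ []) ∷ [])
  ∷ [])

rankTable 4 6 5 = fromTable
  ( ((0 ∷ 21 ∷ 22 ∷ 27 ∷ 28 ∷ []) ∷ (23 ∷ 0 ∷ 21 ∷ 26 ∷ 27 ∷ []) ∷ (24 ∷ 15 ∷ 0 ∷ 1 ∷ 26 ∷ []) ∷ (25 ∷ 14 ∷ 11 ∷ 0 ∷ 1 ∷ []) ∷ (26 ∷ 13 ∷ 12 ∷ 9 ∷ 0 ∷ []) ∷ (27 ∷ 0 ∷ 13 ∷ 14 ∷ 15 ∷ []) ∷ [])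
  ∷ ((21 ∷ 20 ∷ 0 ∷ 26 ∷ 27 ∷ []) ∷ (22 ∷ 19 ∷ 20 ∷ 25 ∷ 26 ∷ []) ∷ (23 ∷ 16 ∷ 1 ∷ 0 ∷ 25 ∷ []) ∷ (24 ∷ 13 ∷ 10 ∷ 1 ∷ 0 ∷ []) ∷ (25 ∷ 10 ∷ 9 ∷ 8 ∷ 7 ∷ []) ∷ (26 ∷ 1 ∷ 0 ∷ 9 ∷ 10 ∷ []) ∷ [])
  ∷ ((20 ∷ 0 ∷ 22 ∷ 25 ∷ 0 ∷ []) ∷ (19 ∷ 18 ∷ 21 ∷ 24 ∷ 25 ∷ []) ∷ (18 ∷ 17 ∷ 0 ∷ 13 ∷ 24 ∷ []) ∷ (0 ∷ 12 ∷ 11 ∷ 12 ∷ 13 ∷ []) ∷ (22 ∷ 1 ∷ 0 ∷ 5 ∷ 6 ∷ []) ∷ (23 ∷ 0 ∷ 1 ∷ 2 ∷ 0 ∷ []) ∷ [])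
  ∷ ((0 ∷ 1 ∷ 23 ∷ 26 ∷ 27 ∷ []) ∷ (1 ∷ 0 ∷ 22 ∷ 23 ∷ 0 ∷ []) ∷ (0 ∷ 18 ∷ 21 ∷ 22 ∷ 23 ∷ []) ∷ (20 ∷ 19 ∷ 20 ∷ 21 ∷ 22 ∷ []) ∷ (21 ∷ 0 ∷ 3 ∷ 4 ∷ 0 ∷ []) ∷ (0 ∷ 1 ∷ 2 ∷ 0 ∷ 1 ∷ []) ∷ [])
  ∷ [])

rankTable 4 6 6 = fromTable
  ( ((19 ∷ 0 ∷ 19 ∷ 20 ∷ 21 ∷ 0 ∷ []) ∷ (18 ∷ 17 ∷ 18 ∷ 19 ∷ 20 ∷ 31 ∷ []) ∷ (9 ∷ 8 ∷ 0 ∷ 10 ∷ 15 ∷ 30 ∷ []) ∷ (0 ∷ 3 ∷ 4 ∷ 0 ∷ 14 ∷ 29 ∷ []) ∷ (1 ∷ 0 ∷ 5 ∷ 10 ∷ 11 ∷ 0 ∷ []) ∷ (32 ∷ 31 ∷ 30 ∷ 29 ∷ 0 ∷ 29 ∷ []) ∷ [])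
  ∷ ((18 ∷ 17 ∷ 18 ∷ 19 ∷ 22 ∷ 33 ∷ []) ∷ (17 ∷ 16 ∷ 0 ∷ 10 ∷ 0 ∷ 32 ∷ []) ∷ (0 ∷ 7 ∷ 6 ∷ 9 ∷ 14 ∷ 29 ∷ []) ∷ (1 ∷ 2 ∷ 5 ∷ 8 ∷ 13 ∷ 28 ∷ []) ∷ (0 ∷ 1 ∷ 0 ∷ 9 ∷ 12 ∷ 27 ∷ []) ∷ (31 ∷ 30 ∷ 29 ∷ 28 ∷ 27 ∷ 28 ∷ []) ∷ [])
  ∷ ((0 ∷ 16 ∷ 17 ∷ 0 ∷ 23 ∷ 34 ∷ []) ∷ (14 ∷ 15 ∷ 12 ∷ 11 ∷ 16 ∷ 33 ∷ []) ∷ (13 ∷ 8 ∷ 7 ∷ 0 ∷ 15 ∷ 16 ∷ []) ∷ (12 ∷ 0 ∷ 6 ∷ 7 ∷ 1 ∷ 0 ∷ []) ∷ (11 ∷ 10 ∷ 9 ∷ 8 ∷ 0 ∷ 26 ∷ []) ∷ (0 ∷ 11 ∷ 12 ∷ 0 ∷ 26 ∷ 27 ∷ []) ∷ [])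
  ∷ ((1 ∷ 0 ∷ 20 ∷ 21 ∷ 24 ∷ 35 ∷ []) ∷ (0 ∷ 16 ∷ 19 ∷ 20 ∷ 21 ∷ 34 ∷ []) ∷ (20 ∷ 19 ∷ 18 ∷ 17 ∷ 16 ∷ 0 ∷ []) ∷ (21 ∷ 20 ∷ 0 ∷ 8 ∷ 0 ∷ 1 ∷ []) ∷ (22 ∷ 21 ∷ 22 ∷ 23 ∷ 24 ∷ 25 ∷ []) ∷ (23 ∷ 0 ∷ 23 ∷ 24 ∷ 25 ∷ 0 ∷ []) ∷ [])
  ∷ [])

rankTable 4 6 7 = fromTable
  ( ((13 ∷ 12 ∷ 11 ∷ 0 ∷ 21 ∷ 38 ∷ 39 ∷ []) ∷ (12 ∷ 11 ∷ 10 ∷ 9 ∷ 20 ∷ 27 ∷ 32 ∷ []) ∷ (7 ∷ 6 ∷ 0 ∷ 8 ∷ 9 ∷ 24 ∷ 31 ∷ []) ∷ (0 ∷ 3 ∷ 0 ∷ 1 ∷ 0 ∷ 23 ∷ 30 ∷ []) ∷ (5 ∷ 4 ∷ 5 ∷ 6 ∷ 7 ∷ 22 ∷ 0 ∷ []) ∷ (6 ∷ 0 ∷ 6 ∷ 7 ∷ 20 ∷ 23 ∷ 24 ∷ []) ∷ [])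
  ∷ ((10 ∷ 9 ∷ 0 ∷ 1 ∷ 20 ∷ 37 ∷ 38 ∷ []) ∷ (9 ∷ 8 ∷ 7 ∷ 0 ∷ 19 ∷ 26 ∷ 31 ∷ []) ∷ (0 ∷ 5 ∷ 6 ∷ 7 ∷ 8 ∷ 0 ∷ 30 ∷ []) ∷ (1 ∷ 2 ∷ 1 ∷ 0 ∷ 1 ∷ 22 ∷ 29 ∷ []) ∷ (2 ∷ 0 ∷ 2 ∷ 1 ∷ 0 ∷ 21 ∷ 22 ∷ []) ∷ (0 ∷ 1 ∷ 3 ∷ 0 ∷ 19 ∷ 20 ∷ 0 ∷ []) ∷ [])
  ∷ ((1 ∷ 0 ∷ 9 ∷ 10 ∷ 0 ∷ 36 ∷ 37 ∷ []) ∷ (0 ∷ 1 ∷ 8 ∷ 11 ∷ 18 ∷ 25 ∷ 30 ∷ []) ∷ (1 ∷ 4 ∷ 7 ∷ 12 ∷ 17 ∷ 24 ∷ 29 ∷ []) ∷ (0 ∷ 3 ∷ 0 ∷ 13 ∷ 16 ∷ 23 ∷ 28 ∷ []) ∷ (17 ∷ 16 ∷ 15 ∷ 14 ∷ 15 ∷ 0 ∷ 23 ∷ []) ∷ (18 ∷ 17 ∷ 16 ∷ 15 ∷ 18 ∷ 19 ∷ 24 ∷ []) ∷ [])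
  ∷ ((0 ∷ 1 ∷ 32 ∷ 33 ∷ 34 ∷ 35 ∷ 0 ∷ []) ∷ (1 ∷ 0 ∷ 31 ∷ 30 ∷ 29 ∷ 0 ∷ 1 ∷ []) ∷ (34 ∷ 33 ∷ 32 ∷ 29 ∷ 28 ∷ 25 ∷ 0 ∷ []) ∷ (35 ∷ 34 ∷ 33 ∷ 28 ∷ 27 ∷ 26 ∷ 27 ∷ []) ∷ (36 ∷ 35 ∷ 34 ∷ 0 ∷ 16 ∷ 1 ∷ 0 ∷ []) ∷ (37 ∷ 36 ∷ 35 ∷ 0 ∷ 17 ∷ 0 ∷ 25 ∷ []) ∷ [])
  ∷ [])

rankTable 4 7 2 = fromTable
  ( ((0 ∷ 1 ∷ []) ∷ (12 ∷ 0 ∷ []) ∷ (11 ∷ 10 ∷ []) ∷ (0 ∷ 9 ∷ []) ∷ (1 ∷ 0 ∷ []) ∷ (0 ∷ 1 ∷ []) ∷ (1 ∷ 0 ∷ []) ∷ [])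
  ∷ ((14 ∷ 0 ∷ []) ∷ (13 ∷ 1 ∷ []) ∷ (10 ∷ 9 ∷ []) ∷ (7 ∷ 8 ∷ []) ∷ (4 ∷ 3 ∷ []) ∷ (1 ∷ 2 ∷ []) ∷ (0 ∷ 3 ∷ []) ∷ [])
  ∷ ((15 ∷ 1 ∷ []) ∷ (14 ∷ 0 ∷ []) ∷ (0 ∷ 1 ∷ []) ∷ (6 ∷ 7 ∷ []) ∷ (5 ∷ 0 ∷ []) ∷ (0 ∷ 1 ∷ []) ∷ (5 ∷ 4 ∷ []) ∷ [])
  ∷ ((16 ∷ 0 ∷ []) ∷ (15 ∷ 1 ∷ []) ∷ (1 ∷ 0 ∷ []) ∷ (0 ∷ 8 ∷ []) ∷ (10 ∷ 9 ∷ []) ∷ (11 ∷ 0 ∷ []) ∷ (12 ∷ 0 ∷ []) ∷ [])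
  ∷ [])

rankTable 4 7 3 = fromTable
  ( ((18 ∷ 0 ∷ 22 ∷ []) ∷ (17 ∷ 16 ∷ 21 ∷ []) ∷ (0 ∷ 15 ∷ 20 ∷ []) ∷ (1 ∷ 0 ∷ 19 ∷ []) ∷ (4 ∷ 3 ∷ 0 ∷ []) ∷ (3 ∷ 2 ∷ 1 ∷ []) ∷ (0 ∷ 1 ∷ 0 ∷ []) ∷ [])
  ∷ ((17 ∷ 16 ∷ 17 ∷ []) ∷ (16 ∷ 15 ∷ 0 ∷ []) ∷ (1 ∷ 14 ∷ 17 ∷ []) ∷ (0 ∷ 5 ∷ 18 ∷ []) ∷ (5 ∷ 4 ∷ 5 ∷ []) ∷ (0 ∷ 1 ∷ 0 ∷ []) ∷ (1 ∷ 0 ∷ 1 ∷ []) ∷ [])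
  ∷ ((0 ∷ 1 ∷ 0 ∷ []) ∷ (15 ∷ 14 ∷ 15 ∷ []) ∷ (0 ∷ 13 ∷ 16 ∷ []) ∷ (1 ∷ 6 ∷ 19 ∷ []) ∷ (6 ∷ 0 ∷ 20 ∷ []) ∷ (7 ∷ 2 ∷ 21 ∷ []) ∷ (8 ∷ 9 ∷ 22 ∷ []) ∷ [])
  ∷ ((17 ∷ 0 ∷ 17 ∷ []) ∷ (16 ∷ 0 ∷ 16 ∷ []) ∷ (13 ∷ 12 ∷ 0 ∷ []) ∷ (0 ∷ 11 ∷ 20 ∷ []) ∷ (9 ∷ 10 ∷ 21 ∷ []) ∷ (8 ∷ 0 ∷ 22 ∷ []) ∷ (0 ∷ 10 ∷ 23 ∷ []) ∷ [])
  ∷ [])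

rankTable 4 7 4 = fromTable
  ( ((1 ∷ 0 ∷ 6 ∷ 13 ∷ []) ∷ (0 ∷ 1 ∷ 0 ∷ 12 ∷ []) ∷ (5 ∷ 6 ∷ 7 ∷ 11 ∷ []) ∷ (0 ∷ 7 ∷ 8 ∷ 10 ∷ []) ∷ (13 ∷ 12 ∷ 11 ∷ 0 ∷ []) ∷ (14 ∷ 13 ∷ 14 ∷ 15 ∷ []) ∷ (15 ∷ 0 ∷ 15 ∷ 16 ∷ []) ∷ [])
  ∷ ((0 ∷ 3 ∷ 5 ∷ 0 ∷ []) ∷ (3 ∷ 2 ∷ 4 ∷ 7 ∷ []) ∷ (4 ∷ 0 ∷ 5 ∷ 8 ∷ []) ∷ (5 ∷ 6 ∷ 7 ∷ 9 ∷ []) ∷ (0 ∷ 9 ∷ 10 ∷ 11 ∷ []) ∷ (11 ∷ 10 ∷ 0 ∷ 12 ∷ []) ∷ (0 ∷ 11 ∷ 12 ∷ 0 ∷ []) ∷ [])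
  ∷ ((10 ∷ 9 ∷ 8 ∷ 7 ∷ []) ∷ (4 ∷ 0 ∷ 3 ∷ 6 ∷ []) ∷ (0 ∷ 1 ∷ 2 ∷ 0 ∷ []) ∷ (6 ∷ 2 ∷ 0 ∷ 1 ∷ []) ∷ (7 ∷ 8 ∷ 11 ∷ 12 ∷ []) ∷ (12 ∷ 0 ∷ 12 ∷ 13 ∷ []) ∷ (13 ∷ 12 ∷ 13 ∷ 14 ∷ []) ∷ [])
  ∷ ((11 ∷ 10 ∷ 9 ∷ 0 ∷ []) ∷ (9 ∷ 5 ∷ 0 ∷ 5 ∷ []) ∷ (8 ∷ 4 ∷ 3 ∷ 4 ∷ []) ∷ (7 ∷ 0 ∷ 1 ∷ 0 ∷ []) ∷ (0 ∷ 9 ∷ 12 ∷ 13 ∷ []) ∷ (13 ∷ 10 ∷ 13 ∷ 14 ∷ []) ∷ (14 ∷ 0 ∷ 14 ∷ 15 ∷ []) ∷ [])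
  ∷ [])

rankTable 4 7 5 = fromTable
  ( ((0 ∷ 23 ∷ 24 ∷ 25 ∷ 26 ∷ []) ∷ (23 ∷ 22 ∷ 0 ∷ 14 ∷ 15 ∷ []) ∷ (0 ∷ 13 ∷ 12 ∷ 13 ∷ 0 ∷ []) ∷ (9 ∷ 10 ∷ 11 ∷ 14 ∷ 15 ∷ []) ∷ (0 ∷ 1 ∷ 2 ∷ 15 ∷ 16 ∷ []) ∷ (3 ∷ 0 ∷ 1 ∷ 16 ∷ 25 ∷ []) ∷ (4 ∷ 3 ∷ 0 ∷ 17 ∷ 26 ∷ []) ∷ [])
  ∷ ((25 ∷ 22 ∷ 0 ∷ 10 ∷ 15 ∷ []) ∷ (24 ∷ 21 ∷ 1 ∷ 9 ∷ 0 ∷ []) ∷ (15 ∷ 14 ∷ 0 ∷ 8 ∷ 1 ∷ []) ∷ (8 ∷ 7 ∷ 6 ∷ 7 ∷ 0 ∷ []) ∷ (3 ∷ 0 ∷ 1 ∷ 0 ∷ 1 ∷ []) ∷ (2 ∷ 1 ∷ 0 ∷ 7 ∷ 24 ∷ []) ∷ (0 ∷ 2 ∷ 3 ∷ 8 ∷ 25 ∷ []) ∷ [])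
  ∷ ((26 ∷ 21 ∷ 14 ∷ 0 ∷ 14 ∷ []) ∷ (25 ∷ 20 ∷ 13 ∷ 10 ∷ 13 ∷ []) ∷ (16 ∷ 15 ∷ 12 ∷ 11 ∷ 12 ∷ []) ∷ (5 ∷ 0 ∷ 5 ∷ 8 ∷ 9 ∷ []) ∷ (4 ∷ 3 ∷ 4 ∷ 5 ∷ 0 ∷ []) ∷ (0 ∷ 2 ∷ 3 ∷ 6 ∷ 23 ∷ []) ∷ (1 ∷ 0 ∷ 4 ∷ 0 ∷ 24 ∷ []) ∷ [])
  ∷ ((27 ∷ 0 ∷ 15 ∷ 1 ∷ 0 ∷ []) ∷ (26 ∷ 19 ∷ 16 ∷ 0 ∷ 14 ∷ []) ∷ (19 ∷ 18 ∷ 17 ∷ 18 ∷ 19 ∷ []) ∷ (0 ∷ 1 ∷ 0 ∷ 19 ∷ 20 ∷ []) ∷ (7 ∷ 6 ∷ 5 ∷ 20 ∷ 21 ∷ []) ∷ (8 ∷ 7 ∷ 0 ∷ 21 ∷ 22 ∷ []) ∷ (25 ∷ 24 ∷ 23 ∷ 22 ∷ 0 ∷ []) ∷ [])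
  ∷ [])

rankTable 4 7 6 = fromTable
  ( ((26 ∷ 23 ∷ 22 ∷ 21 ∷ 20 ∷ 0 ∷ []) ∷ (25 ∷ 0 ∷ 17 ∷ 18 ∷ 19 ∷ 20 ∷ []) ∷ (24 ∷ 17 ∷ 16 ∷ 11 ∷ 0 ∷ 13 ∷ []) ∷ (23 ∷ 18 ∷ 15 ∷ 10 ∷ 9 ∷ 0 ∷ []) ∷ (22 ∷ 19 ∷ 14 ∷ 0 ∷ 10 ∷ 11 ∷ []) ∷ (21 ∷ 20 ∷ 13 ∷ 12 ∷ 11 ∷ 12 ∷ []) ∷ (0 ∷ 21 ∷ 0 ∷ 13 ∷ 0 ∷ 13 ∷ []) ∷ [])
  ∷ ((0 ∷ 12 ∷ 6 ∷ 0 ∷ 13 ∷ 22 ∷ []) ∷ (16 ∷ 11 ∷ 5 ∷ 4 ∷ 12 ∷ 21 ∷ []) ∷ (17 ∷ 10 ∷ 0 ∷ 1 ∷ 9 ∷ 12 ∷ []) ∷ (18 ∷ 9 ∷ 6 ∷ 0 ∷ 8 ∷ 9 ∷ []) ∷ (19 ∷ 0 ∷ 5 ∷ 4 ∷ 7 ∷ 8 ∷ []) ∷ (0 ∷ 1 ∷ 0 ∷ 5 ∷ 6 ∷ 0 ∷ []) ∷ (23 ∷ 22 ∷ 15 ∷ 14 ∷ 7 ∷ 8 ∷ []) ∷ [])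
  ∷ ((14 ∷ 13 ∷ 0 ∷ 1 ∷ 0 ∷ 23 ∷ []) ∷ (15 ∷ 12 ∷ 2 ∷ 3 ∷ 11 ∷ 22 ∷ []) ∷ (1 ∷ 0 ∷ 1 ∷ 0 ∷ 10 ∷ 11 ∷ []) ∷ (0 ∷ 8 ∷ 7 ∷ 1 ∷ 0 ∷ 10 ∷ []) ∷ (20 ∷ 9 ∷ 8 ∷ 3 ∷ 2 ∷ 3 ∷ []) ∷ (21 ∷ 10 ∷ 9 ∷ 0 ∷ 1 ∷ 0 ∷ []) ∷ (24 ∷ 23 ∷ 16 ∷ 15 ∷ 0 ∷ 1 ∷ []) ∷ [])
  ∷ ((0 ∷ 18 ∷ 19 ∷ 22 ∷ 23 ∷ 24 ∷ []) ∷ (16 ∷ 17 ∷ 0 ∷ 21 ∷ 22 ∷ 23 ∷ []) ∷ (0 ∷ 18 ∷ 19 ∷ 20 ∷ 13 ∷ 0 ∷ []) ∷ (24 ∷ 23 ∷ 22 ∷ 21 ∷ 12 ∷ 11 ∷ []) ∷ (25 ∷ 24 ∷ 23 ∷ 22 ∷ 0 ∷ 0 ∷ []) ∷ (26 ∷ 25 ∷ 24 ∷ 23 ∷ 2 ∷ 1 ∷ []) ∷ (27 ∷ 26 ∷ 25 ∷ 24 ∷ 3 ∷ 0 ∷ []) ∷ [])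
  ∷ [])

rankTable 4 7 7 = fromTable
  ( ((0 ∷ 11 ∷ 12 ∷ 15 ∷ 16 ∷ 53 ∷ 54 ∷ []) ∷ (9 ∷ 10 ∷ 0 ∷ 14 ∷ 15 ∷ 52 ∷ 53 ∷ []) ∷ (0 ∷ 11 ∷ 12 ∷ 13 ∷ 0 ∷ 51 ∷ 52 ∷ []) ∷ (1 ∷ 12 ∷ 13 ∷ 14 ∷ 23 ∷ 50 ∷ 51 ∷ []) ∷ (0 ∷ 13 ∷ 14 ∷ 21 ∷ 24 ∷ 49 ∷ 50 ∷ []) ∷ (1 ∷ 0 ∷ 19 ∷ 22 ∷ 25 ∷ 48 ∷ 49 ∷ []) ∷ (0 ∷ 43 ∷ 44 ∷ 45 ∷ 46 ∷ 47 ∷ 0 ∷ []) ∷ [])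
  ∷ ((9 ∷ 10 ∷ 11 ∷ 12 ∷ 0 ∷ 26 ∷ 0 ∷ []) ∷ (8 ∷ 7 ∷ 4 ∷ 0 ∷ 3 ∷ 25 ∷ 26 ∷ []) ∷ (1 ∷ 0 ∷ 3 ∷ 1 ∷ 2 ∷ 0 ∷ 27 ∷ []) ∷ (0 ∷ 1 ∷ 2 ∷ 0 ∷ 22 ∷ 23 ∷ 28 ∷ []) ∷ (15 ∷ 14 ∷ 0 ∷ 20 ∷ 23 ∷ 24 ∷ 35 ∷ []) ∷ (16 ∷ 15 ∷ 18 ∷ 21 ∷ 24 ∷ 33 ∷ 36 ∷ []) ∷ (43 ∷ 42 ∷ 41 ∷ 40 ∷ 39 ∷ 38 ∷ 37 ∷ []) ∷ [])
  ∷ ((0 ∷ 1 ∷ 0 ∷ 13 ∷ 14 ∷ 27 ∷ 28 ∷ []) ∷ (7 ∷ 6 ∷ 5 ∷ 6 ∷ 15 ∷ 24 ∷ 0 ∷ []) ∷ (6 ∷ 5 ∷ 4 ∷ 0 ∷ 16 ∷ 23 ∷ 24 ∷ []) ∷ (7 ∷ 0 ∷ 3 ∷ 4 ∷ 21 ∷ 22 ∷ 0 ∷ []) ∷ (16 ∷ 15 ∷ 16 ∷ 19 ∷ 20 ∷ 0 ∷ 34 ∷ []) ∷ (17 ∷ 0 ∷ 17 ∷ 18 ∷ 0 ∷ 32 ∷ 33 ∷ []) ∷ (44 ∷ 39 ∷ 38 ∷ 0 ∷ 34 ∷ 33 ∷ 0 ∷ []) ∷ [])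
  ∷ ((23 ∷ 0 ∷ 23 ∷ 24 ∷ 0 ∷ 36 ∷ 39 ∷ []) ∷ (22 ∷ 21 ∷ 22 ∷ 25 ∷ 26 ∷ 35 ∷ 38 ∷ []) ∷ (0 ∷ 20 ∷ 21 ∷ 26 ∷ 27 ∷ 34 ∷ 37 ∷ []) ∷ (20 ∷ 19 ∷ 0 ∷ 27 ∷ 28 ∷ 33 ∷ 36 ∷ []) ∷ (21 ∷ 18 ∷ 17 ∷ 28 ∷ 29 ∷ 32 ∷ 35 ∷ []) ∷ (22 ∷ 1 ∷ 0 ∷ 29 ∷ 30 ∷ 31 ∷ 0 ∷ []) ∷ (45 ∷ 0 ∷ 37 ∷ 36 ∷ 35 ∷ 0 ∷ 1 ∷ []) ∷ [])
  ∷ [])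

rankTable 5 2 2 = fromTable
  ( ((1 ∷ 0 ∷ []) ∷ (0 ∷ 3 ∷ []) ∷ [])
  ∷ ((0 ∷ 1 ∷ []) ∷ (1 ∷ 2 ∷ []) ∷ [])
  ∷ ((1 ∷ 0 ∷ []) ∷ (0 ∷ 1 ∷ []) ∷ [])
  ∷ ((2 ∷ 1 ∷ []) ∷ (1 ∷ 0 ∷ []) ∷ [])
  ∷ ((3 ∷ 0 ∷ []) ∷ (0 ∷ 1 ∷ []) ∷ [])
  ∷ [])

rankTable 5 2 3 = fromTable
  ( ((0 ∷ 1 ∷ 0 ∷ []) ∷ (1 ∷ 0 ∷ 1 ∷ []) ∷ [])
  ∷ ((1 ∷ 2 ∷ 3 ∷ []) ∷ (0 ∷ 1 ∷ 0 ∷ []) ∷ [])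
  ∷ ((0 ∷ 3 ∷ 4 ∷ []) ∷ (1 ∷ 2 ∷ 3 ∷ []) ∷ [])
  ∷ ((1 ∷ 2 ∷ 3 ∷ []) ∷ (0 ∷ 1 ∷ 0 ∷ []) ∷ [])
  ∷ ((0 ∷ 1 ∷ 0 ∷ []) ∷ (1 ∷ 0 ∷ 1 ∷ []) ∷ [])
  ∷ [])

rankTable 5 2 4 = fromTable
  ( ((0 ∷ 1 ∷ 0 ∷ 5 ∷ []) ∷ (1 ∷ 0 ∷ 1 ∷ 0 ∷ []) ∷ [])
  ∷ ((5 ∷ 4 ∷ 3 ∷ 4 ∷ []) ∷ (0 ∷ 1 ∷ 2 ∷ 3 ∷ []) ∷ [])
  ∷ ((6 ∷ 5 ∷ 0 ∷ 1 ∷ []) ∷ (7 ∷ 0 ∷ 1 ∷ 0 ∷ []) ∷ [])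
  ∷ ((0 ∷ 6 ∷ 1 ∷ 0 ∷ []) ∷ (8 ∷ 7 ∷ 2 ∷ 1 ∷ []) ∷ [])
  ∷ ((0 ∷ 7 ∷ 0 ∷ 1 ∷ []) ∷ (9 ∷ 8 ∷ 3 ∷ 0 ∷ []) ∷ [])
  ∷ [])

rankTable 5 2 5 = fromTable
  ( ((5 ∷ 4 ∷ 1 ∷ 0 ∷ 9 ∷ []) ∷ (0 ∷ 3 ∷ 0 ∷ 1 ∷ 0 ∷ []) ∷ [])
  ∷ ((0 ∷ 3 ∷ 0 ∷ 5 ∷ 8 ∷ []) ∷ (1 ∷ 2 ∷ 1 ∷ 4 ∷ 5 ∷ []) ∷ [])
  ∷ ((9 ∷ 8 ∷ 7 ∷ 6 ∷ 7 ∷ []) ∷ (0 ∷ 1 ∷ 0 ∷ 3 ∷ 0 ∷ []) ∷ [])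
  ∷ ((10 ∷ 9 ∷ 8 ∷ 3 ∷ 0 ∷ []) ∷ (11 ∷ 0 ∷ 1 ∷ 2 ∷ 1 ∷ []) ∷ [])
  ∷ ((0 ∷ 10 ∷ 9 ∷ 0 ∷ 1 ∷ []) ∷ (12 ∷ 11 ∷ 0 ∷ 1 ∷ 0 ∷ []) ∷ [])
  ∷ [])

rankTable 5 2 6 = fromTable
  ( ((8 ∷ 7 ∷ 0 ∷ 1 ∷ 0 ∷ 1 ∷ []) ∷ (0 ∷ 3 ∷ 1 ∷ 0 ∷ 1 ∷ 0 ∷ []) ∷ [])
  ∷ ((0 ∷ 6 ∷ 5 ∷ 4 ∷ 1 ∷ 0 ∷ []) ∷ (1 ∷ 2 ∷ 0 ∷ 3 ∷ 2 ∷ 1 ∷ []) ∷ [])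
  ∷ ((8 ∷ 7 ∷ 6 ∷ 5 ∷ 0 ∷ 1 ∷ []) ∷ (0 ∷ 0 ∷ 1 ∷ 4 ∷ 3 ∷ 0 ∷ []) ∷ [])
  ∷ ((11 ∷ 8 ∷ 7 ∷ 6 ∷ 0 ∷ 2 ∷ []) ∷ (10 ∷ 9 ∷ 0 ∷ 7 ∷ 8 ∷ 9 ∷ []) ∷ [])
  ∷ ((12 ∷ 0 ∷ 8 ∷ 0 ∷ 1 ∷ 0 ∷ []) ∷ (0 ∷ 10 ∷ 11 ∷ 12 ∷ 13 ∷ 14 ∷ []) ∷ [])
  ∷ [])

rankTable 5 2 7 = fromTable
  ( ((0 ∷ 12 ∷ 11 ∷ 10 ∷ 1 ∷ 0 ∷ 1 ∷ []) ∷ (18 ∷ 17 ∷ 0 ∷ 1 ∷ 0 ∷ 1 ∷ 0 ∷ []) ∷ [])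
  ∷ ((1 ∷ 0 ∷ 10 ∷ 9 ∷ 0 ∷ 1 ∷ 0 ∷ []) ∷ (17 ∷ 16 ∷ 1 ∷ 0 ∷ 1 ∷ 2 ∷ 1 ∷ []) ∷ [])
  ∷ ((0 ∷ 12 ∷ 11 ∷ 8 ∷ 5 ∷ 6 ∷ 7 ∷ []) ∷ (16 ∷ 15 ∷ 0 ∷ 5 ∷ 4 ∷ 3 ∷ 0 ∷ []) ∷ [])
  ∷ ((1 ∷ 13 ∷ 12 ∷ 7 ∷ 0 ∷ 7 ∷ 8 ∷ []) ∷ (0 ∷ 14 ∷ 7 ∷ 6 ∷ 1 ∷ 0 ∷ 9 ∷ []) ∷ [])
  ∷ ((0 ∷ 14 ∷ 13 ∷ 0 ∷ 1 ∷ 8 ∷ 0 ∷ []) ∷ (16 ∷ 15 ∷ 0 ∷ 1 ∷ 0 ∷ 9 ∷ 10 ∷ []) ∷ [])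
  ∷ [])

rankTable 5 3 2 = fromTable
  ( ((1 ∷ 0 ∷ []) ∷ (0 ∷ 4 ∷ []) ∷ (0 ∷ 5 ∷ []) ∷ [])
  ∷ ((0 ∷ 1 ∷ []) ∷ (2 ∷ 3 ∷ []) ∷ (1 ∷ 0 ∷ []) ∷ [])
  ∷ ((1 ∷ 0 ∷ []) ∷ (3 ∷ 4 ∷ []) ∷ (0 ∷ 5 ∷ []) ∷ [])
  ∷ ((0 ∷ 1 ∷ []) ∷ (6 ∷ 5 ∷ []) ∷ (7 ∷ 8 ∷ []) ∷ [])
  ∷ ((8 ∷ 0 ∷ []) ∷ (7 ∷ 0 ∷ []) ∷ (0 ∷ 9 ∷ []) ∷ [])
  ∷ [])

rankTable 5 3 3 = fromTable
  ( ((1 ∷ 0 ∷ 10 ∷ []) ∷ (0 ∷ 4 ∷ 9 ∷ []) ∷ (6 ∷ 5 ∷ 0 ∷ []) ∷ [])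
  ∷ ((0 ∷ 1 ∷ 9 ∷ []) ∷ (4 ∷ 3 ∷ 8 ∷ []) ∷ (5 ∷ 0 ∷ 7 ∷ []) ∷ [])
  ∷ ((6 ∷ 0 ∷ 1 ∷ []) ∷ (5 ∷ 2 ∷ 0 ∷ []) ∷ (0 ∷ 1 ∷ 6 ∷ []) ∷ [])
  ∷ ((7 ∷ 4 ∷ 0 ∷ []) ∷ (8 ∷ 3 ∷ 4 ∷ []) ∷ (9 ∷ 0 ∷ 5 ∷ []) ∷ [])
  ∷ ((0 ∷ 5 ∷ 6 ∷ []) ∷ (9 ∷ 0 ∷ 5 ∷ []) ∷ (10 ∷ 1 ∷ 0 ∷ []) ∷ [])
  ∷ [])

rankTable 5 3 4 = fromTable
  ( ((0 ∷ 21 ∷ 22 ∷ 23 ∷ []) ∷ (23 ∷ 0 ∷ 1 ∷ 0 ∷ []) ∷ (24 ∷ 21 ∷ 0 ∷ 1 ∷ []) ∷ [])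
  ∷ ((21 ∷ 20 ∷ 17 ∷ 0 ∷ []) ∷ (22 ∷ 19 ∷ 2 ∷ 1 ∷ []) ∷ (23 ∷ 20 ∷ 3 ∷ 0 ∷ []) ∷ [])
  ∷ ((0 ∷ 17 ∷ 16 ∷ 15 ∷ []) ∷ (19 ∷ 18 ∷ 0 ∷ 6 ∷ []) ∷ (20 ∷ 19 ∷ 4 ∷ 5 ∷ []) ∷ [])
  ∷ ((1 ∷ 0 ∷ 13 ∷ 14 ∷ []) ∷ (12 ∷ 9 ∷ 8 ∷ 7 ∷ []) ∷ (13 ∷ 0 ∷ 1 ∷ 0 ∷ []) ∷ [])
  ∷ ((0 ∷ 11 ∷ 12 ∷ 0 ∷ []) ∷ (11 ∷ 10 ∷ 9 ∷ 0 ∷ []) ∷ (0 ∷ 1 ∷ 0 ∷ 1 ∷ []) ∷ [])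
  ∷ [])

rankTable 5 3 5 = fromTable
  ( ((11 ∷ 0 ∷ 11 ∷ 12 ∷ 0 ∷ []) ∷ (6 ∷ 5 ∷ 0 ∷ 13 ∷ 14 ∷ []) ∷ (0 ∷ 6 ∷ 7 ∷ 14 ∷ 15 ∷ []) ∷ [])
  ∷ ((10 ∷ 9 ∷ 10 ∷ 11 ∷ 10 ∷ []) ∷ (0 ∷ 4 ∷ 5 ∷ 6 ∷ 0 ∷ []) ∷ (1 ∷ 0 ∷ 6 ∷ 7 ∷ 8 ∷ []) ∷ [])
  ∷ ((9 ∷ 8 ∷ 0 ∷ 8 ∷ 9 ∷ []) ∷ (2 ∷ 3 ∷ 4 ∷ 5 ∷ 2 ∷ []) ∷ (0 ∷ 1 ∷ 0 ∷ 6 ∷ 0 ∷ []) ∷ [])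
  ∷ ((0 ∷ 7 ∷ 6 ∷ 7 ∷ 0 ∷ []) ∷ (1 ∷ 0 ∷ 5 ∷ 0 ∷ 1 ∷ []) ∷ (3 ∷ 2 ∷ 6 ∷ 7 ∷ 8 ∷ []) ∷ [])
  ∷ ((9 ∷ 8 ∷ 0 ∷ 8 ∷ 9 ∷ []) ∷ (0 ∷ 1 ∷ 6 ∷ 7 ∷ 0 ∷ []) ∷ (4 ∷ 0 ∷ 7 ∷ 8 ∷ 9 ∷ []) ∷ [])
  ∷ [])

rankTable 5 3 6 = fromTable
  ( ((1 ∷ 0 ∷ 5 ∷ 6 ∷ 23 ∷ 24 ∷ []) ∷ (0 ∷ 1 ∷ 0 ∷ 5 ∷ 0 ∷ 1 ∷ []) ∷ (17 ∷ 10 ∷ 9 ∷ 8 ∷ 7 ∷ 0 ∷ []) ∷ [])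
  ∷ ((0 ∷ 1 ∷ 4 ∷ 5 ∷ 22 ∷ 23 ∷ []) ∷ (3 ∷ 2 ∷ 3 ∷ 4 ∷ 5 ∷ 0 ∷ []) ∷ (16 ∷ 5 ∷ 4 ∷ 0 ∷ 6 ∷ 7 ∷ []) ∷ [])
  ∷ ((5 ∷ 0 ∷ 1 ∷ 0 ∷ 21 ∷ 22 ∷ []) ∷ (4 ∷ 1 ∷ 0 ∷ 1 ∷ 6 ∷ 7 ∷ []) ∷ (15 ∷ 0 ∷ 3 ∷ 2 ∷ 0 ∷ 8 ∷ []) ∷ [])
  ∷ ((14 ∷ 13 ∷ 14 ∷ 15 ∷ 20 ∷ 21 ∷ []) ∷ (0 ∷ 12 ∷ 11 ∷ 0 ∷ 7 ∷ 0 ∷ []) ∷ (14 ∷ 13 ∷ 10 ∷ 9 ∷ 8 ∷ 9 ∷ []) ∷ [])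
  ∷ ((17 ∷ 0 ∷ 17 ∷ 18 ∷ 19 ∷ 0 ∷ []) ∷ (16 ∷ 15 ∷ 16 ∷ 17 ∷ 18 ∷ 19 ∷ []) ∷ (0 ∷ 14 ∷ 0 ∷ 10 ∷ 0 ∷ 20 ∷ []) ∷ [])
  ∷ [])

rankTable 5 3 7 = fromTable
  ( ((11 ∷ 10 ∷ 9 ∷ 8 ∷ 0 ∷ 10 ∷ 0 ∷ []) ∷ (10 ∷ 0 ∷ 1 ∷ 0 ∷ 4 ∷ 9 ∷ 8 ∷ []) ∷ (0 ∷ 14 ∷ 13 ∷ 12 ∷ 11 ∷ 10 ∷ 0 ∷ []) ∷ [])
  ∷ ((0 ∷ 9 ∷ 8 ∷ 7 ∷ 4 ∷ 11 ∷ 12 ∷ []) ∷ (9 ∷ 8 ∷ 0 ∷ 1 ∷ 3 ∷ 0 ∷ 7 ∷ []) ∷ (16 ∷ 15 ∷ 10 ∷ 0 ∷ 4 ∷ 5 ∷ 6 ∷ []) ∷ [])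
  ∷ ((11 ∷ 10 ∷ 0 ∷ 6 ∷ 0 ∷ 12 ∷ 13 ∷ []) ∷ (0 ∷ 7 ∷ 6 ∷ 5 ∷ 2 ∷ 1 ∷ 0 ∷ []) ∷ (17 ∷ 16 ∷ 9 ∷ 4 ∷ 3 ∷ 0 ∷ 1 ∷ []) ∷ [])
  ∷ ((20 ∷ 19 ∷ 18 ∷ 17 ∷ 16 ∷ 15 ∷ 14 ∷ []) ∷ (19 ∷ 0 ∷ 7 ∷ 6 ∷ 0 ∷ 3 ∷ 4 ∷ []) ∷ (18 ∷ 17 ∷ 8 ∷ 0 ∷ 1 ∷ 2 ∷ 0 ∷ []) ∷ [])
  ∷ ((0 ∷ 22 ∷ 23 ∷ 24 ∷ 25 ∷ 26 ∷ 0 ∷ []) ∷ (20 ∷ 21 ∷ 22 ∷ 23 ∷ 24 ∷ 27 ∷ 28 ∷ []) ∷ (0 ∷ 18 ∷ 0 ∷ 1 ∷ 0 ∷ 28 ∷ 29 ∷ []) ∷ [])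
  ∷ [])

rankTable 5 4 2 = fromTable
  ( ((0 ∷ 7 ∷ []) ∷ (5 ∷ 6 ∷ []) ∷ (4 ∷ 0 ∷ []) ∷ (0 ∷ 1 ∷ []) ∷ [])
  ∷ ((1 ∷ 0 ∷ []) ∷ (0 ∷ 2 ∷ []) ∷ (3 ∷ 1 ∷ []) ∷ (4 ∷ 0 ∷ []) ∷ [])
  ∷ ((0 ∷ 4 ∷ []) ∷ (1 ∷ 3 ∷ []) ∷ (2 ∷ 0 ∷ []) ∷ (5 ∷ 6 ∷ []) ∷ [])
  ∷ ((11 ∷ 10 ∷ []) ∷ (0 ∷ 9 ∷ []) ∷ (1 ∷ 8 ∷ []) ∷ (0 ∷ 7 ∷ []) ∷ [])
  ∷ ((12 ∷ 0 ∷ []) ∷ (11 ∷ 10 ∷ []) ∷ (0 ∷ 9 ∷ []) ∷ (1 ∷ 0 ∷ []) ∷ [])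
  ∷ [])

rankTable 5 4 3 = fromTable
  ( ((17 ∷ 0 ∷ 13 ∷ []) ∷ (16 ∷ 1 ∷ 12 ∷ []) ∷ (15 ∷ 0 ∷ 11 ∷ []) ∷ (0 ∷ 1 ∷ 0 ∷ []) ∷ [])
  ∷ ((16 ∷ 1 ∷ 0 ∷ []) ∷ (15 ∷ 0 ∷ 1 ∷ []) ∷ (14 ∷ 9 ∷ 10 ∷ []) ∷ (13 ∷ 10 ∷ 0 ∷ []) ∷ [])
  ∷ ((7 ∷ 2 ∷ 1 ∷ []) ∷ (6 ∷ 3 ∷ 0 ∷ []) ∷ (0 ∷ 8 ∷ 11 ∷ []) ∷ (12 ∷ 11 ∷ 12 ∷ []) ∷ [])
  ∷ ((0 ∷ 1 ∷ 0 ∷ []) ∷ (5 ∷ 4 ∷ 1 ∷ []) ∷ (1 ∷ 7 ∷ 12 ∷ []) ∷ (0 ∷ 8 ∷ 13 ∷ []) ∷ [])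
  ∷ ((7 ∷ 0 ∷ 1 ∷ []) ∷ (6 ∷ 5 ∷ 0 ∷ []) ∷ (0 ∷ 6 ∷ 13 ∷ []) ∷ (1 ∷ 0 ∷ 14 ∷ []) ∷ [])
  ∷ [])

rankTable 5 4 4 = fromTable
  ( ((24 ∷ 9 ∷ 1 ∷ 0 ∷ []) ∷ (23 ∷ 8 ∷ 0 ∷ 6 ∷ []) ∷ (0 ∷ 3 ∷ 4 ∷ 5 ∷ []) ∷ (1 ∷ 0 ∷ 5 ∷ 0 ∷ []) ∷ [])
  ∷ ((23 ∷ 8 ∷ 0 ∷ 8 ∷ []) ∷ (22 ∷ 7 ∷ 4 ∷ 7 ∷ []) ∷ (1 ∷ 2 ∷ 3 ∷ 0 ∷ []) ∷ (0 ∷ 1 ∷ 6 ∷ 7 ∷ []) ∷ [])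
  ∷ ((22 ∷ 7 ∷ 6 ∷ 11 ∷ []) ∷ (21 ∷ 6 ∷ 5 ∷ 10 ∷ []) ∷ (0 ∷ 1 ∷ 0 ∷ 9 ∷ []) ∷ (1 ∷ 0 ∷ 7 ∷ 8 ∷ []) ∷ [])
  ∷ ((0 ∷ 1 ∷ 0 ∷ 12 ∷ []) ∷ (20 ∷ 0 ∷ 1 ∷ 13 ∷ []) ∷ (19 ∷ 16 ∷ 15 ∷ 14 ∷ []) ∷ (18 ∷ 17 ∷ 16 ∷ 0 ∷ []) ∷ [])
  ∷ ((0 ∷ 2 ∷ 1 ∷ 0 ∷ []) ∷ (21 ∷ 3 ∷ 0 ∷ 14 ∷ []) ∷ (22 ∷ 23 ∷ 24 ∷ 25 ∷ []) ∷ (0 ∷ 24 ∷ 25 ∷ 26 ∷ []) ∷ [])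
  ∷ [])

rankTable 5 4 5 = fromTable
  ( ((0 ∷ 1 ∷ 0 ∷ 19 ∷ 20 ∷ []) ∷ (1 ∷ 0 ∷ 1 ∷ 2 ∷ 5 ∷ []) ∷ (14 ∷ 7 ∷ 0 ∷ 1 ∷ 0 ∷ []) ∷ (15 ∷ 8 ∷ 1 ∷ 0 ∷ 1 ∷ []) ∷ [])
  ∷ ((1 ∷ 6 ∷ 7 ∷ 18 ∷ 19 ∷ []) ∷ (0 ∷ 5 ∷ 4 ∷ 0 ∷ 4 ∷ []) ∷ (13 ∷ 6 ∷ 3 ∷ 2 ∷ 3 ∷ []) ∷ (14 ∷ 7 ∷ 0 ∷ 1 ∷ 0 ∷ []) ∷ [])
  ∷ ((0 ∷ 11 ∷ 12 ∷ 17 ∷ 18 ∷ []) ∷ (11 ∷ 10 ∷ 9 ∷ 8 ∷ 0 ∷ []) ∷ (12 ∷ 0 ∷ 4 ∷ 7 ∷ 8 ∷ []) ∷ (0 ∷ 6 ∷ 5 ∷ 6 ∷ 9 ∷ []) ∷ [])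
  ∷ ((13 ∷ 12 ∷ 13 ∷ 16 ∷ 17 ∷ []) ∷ (12 ∷ 11 ∷ 12 ∷ 13 ∷ 14 ∷ []) ∷ (13 ∷ 1 ∷ 0 ∷ 8 ∷ 9 ∷ []) ∷ (14 ∷ 7 ∷ 1 ∷ 0 ∷ 10 ∷ []) ∷ [])
  ∷ ((14 ∷ 0 ∷ 14 ∷ 15 ∷ 0 ∷ []) ∷ (0 ∷ 1 ∷ 13 ∷ 14 ∷ 15 ∷ []) ∷ (14 ∷ 0 ∷ 1 ∷ 9 ∷ 0 ∷ []) ∷ (15 ∷ 8 ∷ 0 ∷ 10 ∷ 11 ∷ []) ∷ [])
  ∷ [])

rankTable 5 4 6 = fromTable
  ( ((0 ∷ 3 ∷ 20 ∷ 21 ∷ 22 ∷ 23 ∷ []) ∷ (1 ∷ 2 ∷ 7 ∷ 10 ∷ 11 ∷ 12 ∷ []) ∷ (0 ∷ 1 ∷ 0 ∷ 9 ∷ 8 ∷ 0 ∷ []) ∷ (13 ∷ 12 ∷ 11 ∷ 10 ∷ 0 ∷ 14 ∷ []) ∷ [])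
  ∷ ((1 ∷ 2 ∷ 19 ∷ 20 ∷ 9 ∷ 0 ∷ []) ∷ (0 ∷ 1 ∷ 6 ∷ 7 ∷ 8 ∷ 9 ∷ []) ∷ (1 ∷ 0 ∷ 5 ∷ 6 ∷ 7 ∷ 10 ∷ []) ∷ (8 ∷ 7 ∷ 6 ∷ 0 ∷ 1 ∷ 13 ∷ []) ∷ [])
  ∷ ((0 ∷ 1 ∷ 18 ∷ 19 ∷ 0 ∷ 1 ∷ []) ∷ (1 ∷ 0 ∷ 5 ∷ 0 ∷ 1 ∷ 0 ∷ []) ∷ (2 ∷ 3 ∷ 4 ∷ 5 ∷ 6 ∷ 11 ∷ []) ∷ (0 ∷ 4 ∷ 0 ∷ 1 ∷ 0 ∷ 12 ∷ []) ∷ [])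
  ∷ ((1 ∷ 0 ∷ 17 ∷ 20 ∷ 21 ∷ 22 ∷ []) ∷ (18 ∷ 17 ∷ 16 ∷ 15 ∷ 14 ∷ 13 ∷ []) ∷ (19 ∷ 18 ∷ 0 ∷ 6 ∷ 9 ∷ 12 ∷ []) ∷ (20 ∷ 19 ∷ 1 ∷ 7 ∷ 8 ∷ 0 ∷ []) ∷ [])
  ∷ ((0 ∷ 1 ∷ 0 ∷ 21 ∷ 22 ∷ 23 ∷ []) ∷ (19 ∷ 18 ∷ 17 ∷ 18 ∷ 19 ∷ 0 ∷ []) ∷ (20 ∷ 19 ∷ 1 ∷ 0 ∷ 20 ∷ 21 ∷ []) ∷ (21 ∷ 20 ∷ 0 ∷ 8 ∷ 21 ∷ 22 ∷ []) ∷ [])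
  ∷ [])

rankTable 5 4 7 = fromTable
  ( ((1 ∷ 0 ∷ 22 ∷ 23 ∷ 24 ∷ 25 ∷ 26 ∷ []) ∷ (0 ∷ 20 ∷ 21 ∷ 10 ∷ 9 ∷ 8 ∷ 0 ∷ []) ∷ (24 ∷ 23 ∷ 22 ∷ 7 ∷ 0 ∷ 7 ∷ 8 ∷ []) ∷ (25 ∷ 24 ∷ 23 ∷ 0 ∷ 1 ∷ 0 ∷ 17 ∷ []) ∷ [])
  ∷ ((0 ∷ 16 ∷ 21 ∷ 22 ∷ 23 ∷ 24 ∷ 25 ∷ []) ∷ (18 ∷ 19 ∷ 20 ∷ 0 ∷ 4 ∷ 0 ∷ 2 ∷ []) ∷ (23 ∷ 22 ∷ 21 ∷ 6 ∷ 5 ∷ 6 ∷ 7 ∷ []) ∷ (24 ∷ 23 ∷ 22 ∷ 7 ∷ 6 ∷ 7 ∷ 16 ∷ []) ∷ [])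
  ∷ ((16 ∷ 15 ∷ 12 ∷ 0 ∷ 0 ∷ 1 ∷ 0 ∷ []) ∷ (17 ∷ 14 ∷ 11 ∷ 1 ∷ 3 ∷ 2 ∷ 1 ∷ []) ∷ (18 ∷ 0 ∷ 10 ∷ 0 ∷ 4 ∷ 5 ∷ 0 ∷ []) ∷ (19 ∷ 12 ∷ 11 ∷ 8 ∷ 0 ∷ 8 ∷ 15 ∷ []) ∷ [])
  ∷ ((0 ∷ 14 ∷ 7 ∷ 6 ∷ 5 ∷ 0 ∷ 1 ∷ []) ∷ (14 ∷ 13 ∷ 0 ∷ 2 ∷ 4 ∷ 3 ∷ 0 ∷ []) ∷ (15 ∷ 10 ∷ 9 ∷ 6 ∷ 5 ∷ 6 ∷ 7 ∷ []) ∷ (16 ∷ 0 ∷ 10 ∷ 11 ∷ 12 ∷ 13 ∷ 14 ∷ []) ∷ [])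
  ∷ ((16 ∷ 15 ∷ 0 ∷ 7 ∷ 8 ∷ 17 ∷ 18 ∷ []) ∷ (0 ∷ 12 ∷ 1 ∷ 0 ∷ 5 ∷ 16 ∷ 17 ∷ []) ∷ (12 ∷ 11 ∷ 8 ∷ 7 ∷ 0 ∷ 15 ∷ 16 ∷ []) ∷ (0 ∷ 1 ∷ 0 ∷ 12 ∷ 13 ∷ 14 ∷ 0 ∷ []) ∷ [])
  ∷ [])

rankTable 5 5 2 = fromTable
  ( ((5 ∷ 0 ∷ []) ∷ (0 ∷ 1 ∷ []) ∷ (9 ∷ 0 ∷ []) ∷ (10 ∷ 11 ∷ []) ∷ (0 ∷ 12 ∷ []) ∷ [])
  ∷ ((4 ∷ 3 ∷ []) ∷ (3 ∷ 2 ∷ []) ∷ (8 ∷ 1 ∷ []) ∷ (9 ∷ 0 ∷ []) ∷ (10 ∷ 11 ∷ []) ∷ [])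
  ∷ ((1 ∷ 0 ∷ []) ∷ (0 ∷ 1 ∷ []) ∷ (7 ∷ 0 ∷ []) ∷ (8 ∷ 1 ∷ []) ∷ (9 ∷ 0 ∷ []) ∷ [])
  ∷ ((0 ∷ 1 ∷ []) ∷ (5 ∷ 4 ∷ []) ∷ (6 ∷ 3 ∷ []) ∷ (3 ∷ 2 ∷ []) ∷ (0 ∷ 1 ∷ []) ∷ [])
  ∷ ((9 ∷ 0 ∷ []) ∷ (8 ∷ 5 ∷ []) ∷ (7 ∷ 0 ∷ []) ∷ (0 ∷ 1 ∷ []) ∷ (1 ∷ 0 ∷ []) ∷ [])
  ∷ [])

rankTable 5 5 3 = fromTable
  ( ((0 ∷ 10 ∷ 11 ∷ []) ∷ (8 ∷ 7 ∷ 0 ∷ []) ∷ (9 ∷ 0 ∷ 1 ∷ []) ∷ (10 ∷ 7 ∷ 8 ∷ []) ∷ (11 ∷ 0 ∷ 9 ∷ []) ∷ [])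
  ∷ ((8 ∷ 9 ∷ 0 ∷ []) ∷ (7 ∷ 6 ∷ 1 ∷ []) ∷ (6 ∷ 5 ∷ 0 ∷ []) ∷ (0 ∷ 6 ∷ 7 ∷ []) ∷ (10 ∷ 7 ∷ 0 ∷ []) ∷ [])
  ∷ ((0 ∷ 10 ∷ 11 ∷ []) ∷ (1 ∷ 0 ∷ 10 ∷ []) ∷ (0 ∷ 4 ∷ 9 ∷ []) ∷ (2 ∷ 5 ∷ 8 ∷ []) ∷ (9 ∷ 8 ∷ 0 ∷ []) ∷ [])
  ∷ ((12 ∷ 11 ∷ 14 ∷ []) ∷ (0 ∷ 4 ∷ 13 ∷ []) ∷ (2 ∷ 3 ∷ 12 ∷ []) ∷ (1 ∷ 0 ∷ 11 ∷ []) ∷ (0 ∷ 9 ∷ 10 ∷ []) ∷ [])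
  ∷ ((13 ∷ 0 ∷ 15 ∷ []) ∷ (6 ∷ 5 ∷ 14 ∷ []) ∷ (3 ∷ 0 ∷ 13 ∷ []) ∷ (0 ∷ 1 ∷ 12 ∷ []) ∷ (11 ∷ 10 ∷ 0 ∷ []) ∷ [])
  ∷ [])

rankTable 5 5 4 = fromTable
  ( ((14 ∷ 0 ∷ 8 ∷ 0 ∷ []) ∷ (13 ∷ 8 ∷ 7 ∷ 6 ∷ []) ∷ (0 ∷ 1 ∷ 0 ∷ 5 ∷ []) ∷ (25 ∷ 24 ∷ 1 ∷ 0 ∷ []) ∷ (26 ∷ 25 ∷ 0 ∷ 1 ∷ []) ∷ [])
  ∷ ((13 ∷ 12 ∷ 13 ∷ 14 ∷ []) ∷ (12 ∷ 9 ∷ 0 ∷ 5 ∷ []) ∷ (1 ∷ 0 ∷ 1 ∷ 4 ∷ []) ∷ (24 ∷ 23 ∷ 2 ∷ 3 ∷ []) ∷ (25 ∷ 24 ∷ 1 ∷ 0 ∷ []) ∷ [])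
  ∷ ((0 ∷ 11 ∷ 14 ∷ 15 ∷ []) ∷ (11 ∷ 10 ∷ 3 ∷ 0 ∷ []) ∷ (0 ∷ 1 ∷ 2 ∷ 0 ∷ []) ∷ (23 ∷ 22 ∷ 3 ∷ 4 ∷ []) ∷ (0 ∷ 23 ∷ 0 ∷ 5 ∷ []) ∷ [])
  ∷ ((13 ∷ 0 ∷ 15 ∷ 20 ∷ []) ∷ (12 ∷ 11 ∷ 16 ∷ 19 ∷ []) ∷ (1 ∷ 0 ∷ 17 ∷ 18 ∷ []) ∷ (24 ∷ 21 ∷ 20 ∷ 21 ∷ []) ∷ (25 ∷ 24 ∷ 21 ∷ 22 ∷ []) ∷ [])
  ∷ ((22 ∷ 21 ∷ 0 ∷ 21 ∷ []) ∷ (21 ∷ 20 ∷ 19 ∷ 20 ∷ []) ∷ (0 ∷ 1 ∷ 18 ∷ 0 ∷ []) ∷ (25 ∷ 0 ∷ 19 ∷ 22 ∷ []) ∷ (26 ∷ 25 ∷ 0 ∷ 23 ∷ []) ∷ [])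
  ∷ [])

rankTable 5 5 5 = fromTable
  ( ((5 ∷ 4 ∷ 0 ∷ 34 ∷ 45 ∷ []) ∷ (0 ∷ 3 ∷ 4 ∷ 33 ∷ 44 ∷ []) ∷ (5 ∷ 0 ∷ 9 ∷ 32 ∷ 0 ∷ []) ∷ (12 ∷ 11 ∷ 12 ∷ 33 ∷ 34 ∷ []) ∷ (19 ∷ 0 ∷ 13 ∷ 34 ∷ 35 ∷ []) ∷ [])
  ∷ ((0 ∷ 3 ∷ 4 ∷ 33 ∷ 44 ∷ []) ∷ (1 ∷ 2 ∷ 0 ∷ 32 ∷ 43 ∷ []) ∷ (4 ∷ 3 ∷ 8 ∷ 31 ∷ 32 ∷ []) ∷ (11 ∷ 10 ∷ 9 ∷ 30 ∷ 33 ∷ []) ∷ (18 ∷ 11 ∷ 0 ∷ 29 ∷ 0 ∷ []) ∷ [])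
  ∷ ((1 ∷ 0 ∷ 5 ∷ 0 ∷ 43 ∷ []) ∷ (0 ∷ 1 ∷ 6 ∷ 7 ∷ 42 ∷ []) ∷ (1 ∷ 0 ∷ 7 ∷ 8 ∷ 0 ∷ []) ∷ (0 ∷ 1 ∷ 0 ∷ 9 ∷ 34 ∷ []) ∷ (17 ∷ 16 ∷ 17 ∷ 28 ∷ 35 ∷ []) ∷ [])
  ∷ ((18 ∷ 19 ∷ 20 ∷ 21 ∷ 42 ∷ []) ∷ (17 ∷ 12 ∷ 11 ∷ 0 ∷ 41 ∷ []) ∷ (16 ∷ 13 ∷ 10 ∷ 9 ∷ 38 ∷ []) ∷ (15 ∷ 14 ∷ 1 ∷ 0 ∷ 37 ∷ []) ∷ (0 ∷ 15 ∷ 18 ∷ 27 ∷ 36 ∷ []) ∷ [])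
  ∷ ((0 ∷ 20 ∷ 21 ∷ 22 ∷ 0 ∷ []) ∷ (18 ∷ 0 ∷ 18 ∷ 23 ∷ 40 ∷ []) ∷ (19 ∷ 16 ∷ 17 ∷ 24 ∷ 39 ∷ []) ∷ (20 ∷ 15 ∷ 0 ∷ 25 ∷ 38 ∷ []) ∷ (21 ∷ 0 ∷ 19 ∷ 26 ∷ 0 ∷ []) ∷ [])
  ∷ [])

rankTable 5 5 6 = fromTable
  ( ((0 ∷ 23 ∷ 24 ∷ 25 ∷ 26 ∷ 27 ∷ []) ∷ (25 ∷ 22 ∷ 0 ∷ 12 ∷ 13 ∷ 14 ∷ []) ∷ (26 ∷ 21 ∷ 1 ∷ 11 ∷ 12 ∷ 13 ∷ []) ∷ (27 ∷ 20 ∷ 0 ∷ 10 ∷ 1 ∷ 0 ∷ []) ∷ (28 ∷ 0 ∷ 1 ∷ 11 ∷ 0 ∷ 1 ∷ []) ∷ [])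
  ∷ ((25 ∷ 0 ∷ 13 ∷ 14 ∷ 15 ∷ 16 ∷ []) ∷ (24 ∷ 15 ∷ 1 ∷ 0 ∷ 12 ∷ 13 ∷ []) ∷ (23 ∷ 18 ∷ 0 ∷ 8 ∷ 11 ∷ 12 ∷ []) ∷ (0 ∷ 19 ∷ 1 ∷ 9 ∷ 0 ∷ 1 ∷ []) ∷ (21 ∷ 20 ∷ 0 ∷ 10 ∷ 1 ∷ 0 ∷ []) ∷ [])
  ∷ ((26 ∷ 13 ∷ 12 ∷ 11 ∷ 0 ∷ 1 ∷ []) ∷ (0 ∷ 14 ∷ 5 ∷ 6 ∷ 7 ∷ 0 ∷ []) ∷ (22 ∷ 17 ∷ 4 ∷ 7 ∷ 10 ∷ 11 ∷ []) ∷ (21 ∷ 20 ∷ 0 ∷ 10 ∷ 11 ∷ 12 ∷ []) ∷ (0 ∷ 21 ∷ 22 ∷ 23 ∷ 24 ∷ 25 ∷ []) ∷ [])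
  ∷ ((35 ∷ 0 ∷ 1 ∷ 10 ∷ 9 ∷ 0 ∷ []) ∷ (34 ∷ 15 ∷ 0 ∷ 1 ∷ 8 ∷ 1 ∷ []) ∷ (33 ∷ 16 ∷ 3 ∷ 0 ∷ 9 ∷ 0 ∷ []) ∷ (32 ∷ 21 ∷ 4 ∷ 11 ∷ 12 ∷ 13 ∷ []) ∷ (31 ∷ 30 ∷ 29 ∷ 28 ∷ 27 ∷ 26 ∷ []) ∷ [])
  ∷ ((36 ∷ 17 ∷ 0 ∷ 11 ∷ 38 ∷ 39 ∷ []) ∷ (35 ∷ 16 ∷ 1 ∷ 0 ∷ 37 ∷ 38 ∷ []) ∷ (34 ∷ 0 ∷ 2 ∷ 3 ∷ 36 ∷ 37 ∷ []) ∷ (33 ∷ 22 ∷ 0 ∷ 12 ∷ 35 ∷ 36 ∷ []) ∷ (0 ∷ 31 ∷ 32 ∷ 33 ∷ 34 ∷ 0 ∷ []) ∷ [])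
  ∷ [])

rankTable 5 5 7 = fromTable
  ( ((32 ∷ 31 ∷ 0 ∷ 23 ∷ 24 ∷ 25 ∷ 0 ∷ []) ∷ (31 ∷ 22 ∷ 21 ∷ 22 ∷ 23 ∷ 0 ∷ 25 ∷ []) ∷ (0 ∷ 7 ∷ 8 ∷ 0 ∷ 24 ∷ 25 ∷ 26 ∷ []) ∷ (7 ∷ 6 ∷ 0 ∷ 18 ∷ 25 ∷ 26 ∷ 27 ∷ []) ∷ (8 ∷ 0 ∷ 14 ∷ 19 ∷ 26 ∷ 27 ∷ 28 ∷ []) ∷ [])
  ∷ ((31 ∷ 30 ∷ 21 ∷ 0 ∷ 1 ∷ 26 ∷ 27 ∷ []) ∷ (30 ∷ 21 ∷ 20 ∷ 17 ∷ 0 ∷ 19 ∷ 24 ∷ []) ∷ (7 ∷ 0 ∷ 9 ∷ 16 ∷ 17 ∷ 18 ∷ 0 ∷ []) ∷ (6 ∷ 5 ∷ 10 ∷ 17 ∷ 18 ∷ 0 ∷ 24 ∷ []) ∷ (0 ∷ 4 ∷ 13 ∷ 18 ∷ 19 ∷ 20 ∷ 25 ∷ []) ∷ [])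
  ∷ ((30 ∷ 29 ∷ 22 ∷ 19 ∷ 0 ∷ 27 ∷ 28 ∷ []) ∷ (29 ∷ 0 ∷ 19 ∷ 18 ∷ 17 ∷ 20 ∷ 23 ∷ []) ∷ (8 ∷ 1 ∷ 0 ∷ 15 ∷ 16 ∷ 19 ∷ 22 ∷ []) ∷ (0 ∷ 2 ∷ 11 ∷ 12 ∷ 0 ∷ 1 ∷ 23 ∷ []) ∷ (1 ∷ 3 ∷ 12 ∷ 0 ∷ 16 ∷ 17 ∷ 24 ∷ []) ∷ [])
  ∷ ((29 ∷ 28 ∷ 25 ∷ 24 ∷ 25 ∷ 28 ∷ 29 ∷ []) ∷ (28 ∷ 25 ∷ 24 ∷ 23 ∷ 22 ∷ 21 ∷ 0 ∷ []) ∷ (9 ∷ 10 ∷ 13 ∷ 14 ∷ 0 ∷ 20 ∷ 21 ∷ []) ∷ (1 ∷ 0 ∷ 12 ∷ 13 ∷ 1 ∷ 0 ∷ 1 ∷ []) ∷ (0 ∷ 1 ∷ 13 ∷ 14 ∷ 15 ∷ 16 ∷ 0 ∷ []) ∷ [])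
  ∷ ((0 ∷ 27 ∷ 26 ∷ 0 ∷ 26 ∷ 29 ∷ 30 ∷ []) ∷ (27 ∷ 26 ∷ 25 ∷ 24 ∷ 25 ∷ 26 ∷ 27 ∷ []) ∷ (0 ∷ 11 ∷ 14 ∷ 17 ∷ 18 ∷ 21 ∷ 22 ∷ []) ∷ (2 ∷ 1 ∷ 0 ∷ 16 ∷ 17 ∷ 18 ∷ 0 ∷ []) ∷ (3 ∷ 0 ∷ 14 ∷ 15 ∷ 0 ∷ 19 ∷ 20 ∷ []) ∷ [])
  ∷ [])

rankTable 5 6 2 = fromTable
  ( ((1 ∷ 0 ∷ []) ∷ (0 ∷ 6 ∷ []) ∷ (1 ∷ 7 ∷ []) ∷ (0 ∷ 8 ∷ []) ∷ (10 ∷ 9 ∷ []) ∷ (11 ∷ 0 ∷ []) ∷ [])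
  ∷ ((0 ∷ 1 ∷ []) ∷ (1 ∷ 5 ∷ []) ∷ (0 ∷ 6 ∷ []) ∷ (1 ∷ 7 ∷ []) ∷ (0 ∷ 8 ∷ []) ∷ (10 ∷ 9 ∷ []) ∷ [])
  ∷ ((4 ∷ 0 ∷ []) ∷ (3 ∷ 4 ∷ []) ∷ (2 ∷ 0 ∷ []) ∷ (3 ∷ 4 ∷ []) ∷ (4 ∷ 7 ∷ []) ∷ (0 ∷ 8 ∷ []) ∷ [])
  ∷ ((5 ∷ 4 ∷ []) ∷ (0 ∷ 3 ∷ []) ∷ (1 ∷ 2 ∷ []) ∷ (0 ∷ 3 ∷ []) ∷ (5 ∷ 6 ∷ []) ∷ (1 ∷ 0 ∷ []) ∷ [])
  ∷ ((6 ∷ 0 ∷ []) ∷ (1 ∷ 0 ∷ []) ∷ (0 ∷ 1 ∷ []) ∷ (1 ∷ 0 ∷ []) ∷ (6 ∷ 7 ∷ []) ∷ (0 ∷ 8 ∷ []) ∷ [])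
  ∷ [])

rankTable 5 6 3 = fromTable
  ( ((9 ∷ 0 ∷ 9 ∷ []) ∷ (0 ∷ 1 ∷ 8 ∷ []) ∷ (9 ∷ 2 ∷ 0 ∷ []) ∷ (10 ∷ 0 ∷ 14 ∷ []) ∷ (17 ∷ 18 ∷ 19 ∷ []) ∷ (0 ∷ 19 ∷ 20 ∷ []) ∷ [])
  ∷ ((8 ∷ 1 ∷ 0 ∷ []) ∷ (7 ∷ 0 ∷ 7 ∷ []) ∷ (8 ∷ 5 ∷ 6 ∷ []) ∷ (9 ∷ 6 ∷ 13 ∷ []) ∷ (16 ∷ 15 ∷ 16 ∷ []) ∷ (17 ∷ 0 ∷ 17 ∷ []) ∷ [])
  ∷ ((0 ∷ 6 ∷ 9 ∷ []) ∷ (6 ∷ 5 ∷ 8 ∷ []) ∷ (0 ∷ 4 ∷ 0 ∷ []) ∷ (1 ∷ 5 ∷ 12 ∷ []) ∷ (0 ∷ 14 ∷ 13 ∷ []) ∷ (18 ∷ 15 ∷ 0 ∷ []) ∷ [])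
  ∷ ((8 ∷ 7 ∷ 10 ∷ []) ∷ (7 ∷ 0 ∷ 9 ∷ []) ∷ (1 ∷ 3 ∷ 10 ∷ []) ∷ (0 ∷ 4 ∷ 11 ∷ []) ∷ (16 ∷ 15 ∷ 0 ∷ []) ∷ (19 ∷ 16 ∷ 1 ∷ []) ∷ [])
  ∷ ((9 ∷ 0 ∷ 11 ∷ []) ∷ (8 ∷ 1 ∷ 0 ∷ []) ∷ (0 ∷ 2 ∷ 11 ∷ []) ∷ (1 ∷ 0 ∷ 12 ∷ []) ∷ (17 ∷ 16 ∷ 13 ∷ []) ∷ (20 ∷ 17 ∷ 0 ∷ []) ∷ [])
  ∷ [])

rankTable 5 6 4 = fromTable
  ( ((19 ∷ 8 ∷ 0 ∷ 1 ∷ []) ∷ (18 ∷ 7 ∷ 1 ∷ 0 ∷ []) ∷ (17 ∷ 6 ∷ 0 ∷ 8 ∷ []) ∷ (16 ∷ 0 ∷ 8 ∷ 9 ∷ []) ∷ (0 ∷ 1 ∷ 21 ∷ 22 ∷ []) ∷ (1 ∷ 0 ∷ 22 ∷ 23 ∷ []) ∷ [])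
  ∷ ((8 ∷ 7 ∷ 3 ∷ 0 ∷ []) ∷ (7 ∷ 0 ∷ 2 ∷ 3 ∷ []) ∷ (0 ∷ 5 ∷ 6 ∷ 7 ∷ []) ∷ (15 ∷ 6 ∷ 7 ∷ 0 ∷ []) ∷ (16 ∷ 17 ∷ 20 ∷ 21 ∷ []) ∷ (0 ∷ 18 ∷ 21 ∷ 22 ∷ []) ∷ [])
  ∷ ((7 ∷ 6 ∷ 5 ∷ 6 ∷ []) ∷ (6 ∷ 3 ∷ 0 ∷ 7 ∷ []) ∷ (5 ∷ 4 ∷ 5 ∷ 8 ∷ []) ∷ (14 ∷ 0 ∷ 8 ∷ 9 ∷ []) ∷ (19 ∷ 18 ∷ 19 ∷ 20 ∷ []) ∷ (20 ∷ 19 ∷ 20 ∷ 21 ∷ []) ∷ [])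
  ∷ ((0 ∷ 3 ∷ 4 ∷ 0 ∷ []) ∷ (3 ∷ 2 ∷ 1 ∷ 8 ∷ []) ∷ (0 ∷ 1 ∷ 0 ∷ 9 ∷ []) ∷ (13 ∷ 12 ∷ 11 ∷ 10 ∷ []) ∷ (20 ∷ 17 ∷ 12 ∷ 0 ∷ []) ∷ (21 ∷ 18 ∷ 0 ∷ 1 ∷ []) ∷ [])
  ∷ ((5 ∷ 0 ∷ 5 ∷ 20 ∷ []) ∷ (4 ∷ 1 ∷ 0 ∷ 19 ∷ []) ∷ (1 ∷ 0 ∷ 1 ∷ 18 ∷ []) ∷ (0 ∷ 13 ∷ 14 ∷ 17 ∷ []) ∷ (21 ∷ 16 ∷ 15 ∷ 16 ∷ []) ∷ (22 ∷ 0 ∷ 1 ∷ 0 ∷ []) ∷ [])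
  ∷ [])

rankTable 5 6 5 = fromTable
  ( ((26 ∷ 21 ∷ 20 ∷ 15 ∷ 0 ∷ []) ∷ (25 ∷ 20 ∷ 19 ∷ 14 ∷ 13 ∷ []) ∷ (8 ∷ 0 ∷ 6 ∷ 0 ∷ 12 ∷ []) ∷ (7 ∷ 6 ∷ 7 ∷ 8 ∷ 11 ∷ []) ∷ (0 ∷ 5 ∷ 8 ∷ 9 ∷ 10 ∷ []) ∷ (7 ∷ 0 ∷ 9 ∷ 10 ∷ 0 ∷ []) ∷ [])
  ∷ ((25 ∷ 20 ∷ 19 ∷ 0 ∷ 1 ∷ []) ∷ (24 ∷ 19 ∷ 18 ∷ 1 ∷ 0 ∷ []) ∷ (7 ∷ 6 ∷ 5 ∷ 2 ∷ 11 ∷ []) ∷ (6 ∷ 5 ∷ 4 ∷ 3 ∷ 10 ∷ []) ∷ (5 ∷ 4 ∷ 3 ∷ 0 ∷ 9 ∷ []) ∷ (6 ∷ 1 ∷ 0 ∷ 7 ∷ 8 ∷ []) ∷ [])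
  ∷ ((24 ∷ 0 ∷ 18 ∷ 15 ∷ 14 ∷ []) ∷ (23 ∷ 18 ∷ 17 ∷ 0 ∷ 13 ∷ []) ∷ (0 ∷ 3 ∷ 0 ∷ 1 ∷ 12 ∷ []) ∷ (3 ∷ 2 ∷ 1 ∷ 0 ∷ 9 ∷ []) ∷ (0 ∷ 1 ∷ 2 ∷ 1 ∷ 0 ∷ []) ∷ (1 ∷ 0 ∷ 3 ∷ 6 ∷ 7 ∷ []) ∷ [])
  ∷ ((23 ∷ 20 ∷ 19 ∷ 16 ∷ 0 ∷ []) ∷ (22 ∷ 19 ∷ 16 ∷ 15 ∷ 14 ∷ []) ∷ (5 ∷ 6 ∷ 7 ∷ 8 ∷ 13 ∷ []) ∷ (4 ∷ 1 ∷ 0 ∷ 7 ∷ 8 ∷ []) ∷ (1 ∷ 0 ∷ 3 ∷ 6 ∷ 7 ∷ []) ∷ (0 ∷ 1 ∷ 4 ∷ 5 ∷ 0 ∷ []) ∷ [])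
  ∷ ((0 ∷ 21 ∷ 22 ∷ 23 ∷ 24 ∷ []) ∷ (21 ∷ 20 ∷ 0 ∷ 16 ∷ 17 ∷ []) ∷ (0 ∷ 7 ∷ 8 ∷ 11 ∷ 14 ∷ []) ∷ (5 ∷ 0 ∷ 9 ∷ 10 ∷ 0 ∷ []) ∷ (14 ∷ 13 ∷ 12 ∷ 11 ∷ 12 ∷ []) ∷ (15 ∷ 14 ∷ 13 ∷ 0 ∷ 13 ∷ []) ∷ [])
  ∷ [])

rankTable 5 6 6 = fromTable
  ( ((0 ∷ 30 ∷ 29 ∷ 28 ∷ 0 ∷ 28 ∷ []) ∷ (30 ∷ 29 ∷ 28 ∷ 27 ∷ 26 ∷ 27 ∷ []) ∷ (13 ∷ 0 ∷ 17 ∷ 18 ∷ 0 ∷ 1 ∷ []) ∷ (0 ∷ 9 ∷ 16 ∷ 0 ∷ 1 ∷ 0 ∷ []) ∷ (43 ∷ 42 ∷ 41 ∷ 40 ∷ 39 ∷ 40 ∷ []) ∷ (44 ∷ 43 ∷ 42 ∷ 41 ∷ 0 ∷ 41 ∷ []) ∷ [])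
  ∷ ((32 ∷ 31 ∷ 0 ∷ 27 ∷ 26 ∷ 0 ∷ []) ∷ (31 ∷ 0 ∷ 13 ∷ 24 ∷ 25 ∷ 1 ∷ []) ∷ (12 ∷ 9 ∷ 14 ∷ 19 ∷ 20 ∷ 0 ∷ []) ∷ (7 ∷ 8 ∷ 15 ∷ 16 ∷ 21 ∷ 22 ∷ []) ∷ (0 ∷ 4 ∷ 16 ∷ 17 ∷ 38 ∷ 39 ∷ []) ∷ (6 ∷ 0 ∷ 17 ∷ 40 ∷ 39 ∷ 0 ∷ []) ∷ [])
  ∷ ((33 ∷ 32 ∷ 13 ∷ 28 ∷ 29 ∷ 30 ∷ []) ∷ (32 ∷ 11 ∷ 12 ∷ 23 ∷ 26 ∷ 0 ∷ []) ∷ (11 ∷ 10 ∷ 11 ∷ 20 ∷ 27 ∷ 28 ∷ []) ∷ (6 ∷ 5 ∷ 0 ∷ 1 ∷ 28 ∷ 29 ∷ []) ∷ (4 ∷ 3 ∷ 1 ∷ 0 ∷ 37 ∷ 40 ∷ []) ∷ (5 ∷ 2 ∷ 0 ∷ 41 ∷ 42 ∷ 43 ∷ []) ∷ [])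
  ∷ ((34 ∷ 33 ∷ 0 ∷ 29 ∷ 30 ∷ 45 ∷ []) ∷ (33 ∷ 0 ∷ 9 ∷ 22 ∷ 31 ∷ 44 ∷ []) ∷ (8 ∷ 7 ∷ 8 ∷ 21 ∷ 32 ∷ 43 ∷ []) ∷ (0 ∷ 4 ∷ 3 ∷ 0 ∷ 33 ∷ 42 ∷ []) ∷ (1 ∷ 0 ∷ 2 ∷ 3 ∷ 36 ∷ 41 ∷ []) ∷ (0 ∷ 1 ∷ 3 ∷ 42 ∷ 43 ∷ 44 ∷ []) ∷ [])
  ∷ ((35 ∷ 34 ∷ 31 ∷ 30 ∷ 0 ∷ 46 ∷ []) ∷ (34 ∷ 11 ∷ 10 ∷ 0 ∷ 32 ∷ 45 ∷ []) ∷ (0 ∷ 6 ∷ 0 ∷ 22 ∷ 33 ∷ 44 ∷ []) ∷ (6 ∷ 5 ∷ 4 ∷ 23 ∷ 34 ∷ 43 ∷ []) ∷ (7 ∷ 1 ∷ 0 ∷ 24 ∷ 35 ∷ 0 ∷ []) ∷ (8 ∷ 0 ∷ 4 ∷ 43 ∷ 44 ∷ 45 ∷ []) ∷ [])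
  ∷ [])

rankTable 5 6 7 = fromTable
  ( ((23 ∷ 12 ∷ 11 ∷ 0 ∷ 11 ∷ 12 ∷ 33 ∷ []) ∷ (22 ∷ 0 ∷ 10 ∷ 9 ∷ 10 ∷ 11 ∷ 32 ∷ []) ∷ (21 ∷ 12 ∷ 11 ∷ 8 ∷ 7 ∷ 0 ∷ 31 ∷ []) ∷ (20 ∷ 13 ∷ 12 ∷ 0 ∷ 1 ∷ 2 ∷ 30 ∷ []) ∷ (19 ∷ 18 ∷ 17 ∷ 16 ∷ 0 ∷ 3 ∷ 29 ∷ []) ∷ (0 ∷ 35 ∷ 34 ∷ 33 ∷ 32 ∷ 31 ∷ 0 ∷ []) ∷ [])
  ∷ ((12 ∷ 11 ∷ 8 ∷ 5 ∷ 8 ∷ 11 ∷ 12 ∷ []) ∷ (0 ∷ 8 ∷ 7 ∷ 0 ∷ 7 ∷ 8 ∷ 0 ∷ []) ∷ (12 ∷ 11 ∷ 6 ∷ 5 ∷ 6 ∷ 7 ∷ 8 ∷ []) ∷ (13 ∷ 12 ∷ 0 ∷ 1 ∷ 0 ∷ 1 ∷ 0 ∷ []) ∷ (0 ∷ 13 ∷ 14 ∷ 15 ∷ 1 ∷ 0 ∷ 28 ∷ []) ∷ (37 ∷ 36 ∷ 33 ∷ 32 ∷ 31 ∷ 30 ∷ 29 ∷ []) ∷ [])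
  ∷ ((0 ∷ 10 ∷ 0 ∷ 4 ∷ 0 ∷ 10 ∷ 0 ∷ []) ∷ (1 ∷ 9 ∷ 4 ∷ 3 ∷ 2 ∷ 9 ∷ 10 ∷ []) ∷ (0 ∷ 10 ∷ 0 ∷ 4 ∷ 0 ∷ 10 ∷ 11 ∷ []) ∷ (14 ∷ 11 ∷ 12 ∷ 13 ∷ 14 ∷ 15 ∷ 16 ∷ []) ∷ (15 ∷ 0 ∷ 13 ∷ 16 ∷ 17 ∷ 18 ∷ 27 ∷ []) ∷ (38 ∷ 37 ∷ 0 ∷ 23 ∷ 24 ∷ 27 ∷ 28 ∷ []) ∷ [])
  ∷ ((18 ∷ 17 ∷ 16 ∷ 5 ∷ 6 ∷ 11 ∷ 12 ∷ []) ∷ (13 ∷ 14 ∷ 15 ∷ 0 ∷ 1 ∷ 0 ∷ 11 ∷ []) ∷ (12 ∷ 11 ∷ 16 ∷ 17 ∷ 18 ∷ 19 ∷ 20 ∷ []) ∷ (13 ∷ 0 ∷ 17 ∷ 18 ∷ 19 ∷ 20 ∷ 21 ∷ []) ∷ (24 ∷ 23 ∷ 22 ∷ 21 ∷ 20 ∷ 21 ∷ 26 ∷ []) ∷ (39 ∷ 38 ∷ 23 ∷ 22 ∷ 0 ∷ 26 ∷ 27 ∷ []) ∷ [])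
  ∷ ((19 ∷ 18 ∷ 17 ∷ 0 ∷ 7 ∷ 12 ∷ 13 ∷ []) ∷ (0 ∷ 15 ∷ 16 ∷ 1 ∷ 0 ∷ 1 ∷ 0 ∷ []) ∷ (1 ∷ 0 ∷ 17 ∷ 18 ∷ 19 ∷ 20 ∷ 21 ∷ []) ∷ (0 ∷ 1 ∷ 18 ∷ 19 ∷ 20 ∷ 21 ∷ 22 ∷ []) ∷ (25 ∷ 24 ∷ 23 ∷ 22 ∷ 23 ∷ 24 ∷ 25 ∷ []) ∷ (40 ∷ 39 ∷ 24 ∷ 0 ∷ 24 ∷ 25 ∷ 0 ∷ []) ∷ [])
  ∷ [])

rankTable 5 7 2 = fromTable
  ( ((1 ∷ 0 ∷ []) ∷ (0 ∷ 10 ∷ []) ∷ (8 ∷ 9 ∷ []) ∷ (7 ∷ 0 ∷ []) ∷ (6 ∷ 1 ∷ []) ∷ (5 ∷ 0 ∷ []) ∷ (0 ∷ 1 ∷ []) ∷ [])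
  ∷ ((0 ∷ 12 ∷ []) ∷ (1 ∷ 11 ∷ []) ∷ (7 ∷ 8 ∷ []) ∷ (6 ∷ 1 ∷ []) ∷ (5 ∷ 0 ∷ []) ∷ (4 ∷ 1 ∷ []) ∷ (1 ∷ 0 ∷ []) ∷ [])
  ∷ ((14 ∷ 13 ∷ []) ∷ (0 ∷ 12 ∷ []) ∷ (6 ∷ 7 ∷ []) ∷ (5 ∷ 0 ∷ []) ∷ (0 ∷ 1 ∷ []) ∷ (3 ∷ 2 ∷ []) ∷ (0 ∷ 3 ∷ []) ∷ [])
  ∷ ((15 ∷ 0 ∷ []) ∷ (14 ∷ 13 ∷ []) ∷ (0 ∷ 4 ∷ []) ∷ (4 ∷ 3 ∷ []) ∷ (5 ∷ 2 ∷ []) ∷ (6 ∷ 0 ∷ []) ∷ (7 ∷ 4 ∷ []) ∷ [])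
  ∷ ((16 ∷ 0 ∷ []) ∷ (15 ∷ 14 ∷ []) ∷ (1 ∷ 0 ∷ []) ∷ (0 ∷ 1 ∷ []) ∷ (6 ∷ 0 ∷ []) ∷ (7 ∷ 1 ∷ []) ∷ (8 ∷ 0 ∷ []) ∷ [])
  ∷ [])

rankTable 5 7 3 = fromTable
  ( ((0 ∷ 30 ∷ 31 ∷ []) ∷ (28 ∷ 29 ∷ 30 ∷ []) ∷ (27 ∷ 26 ∷ 0 ∷ []) ∷ (0 ∷ 23 ∷ 24 ∷ []) ∷ (21 ∷ 0 ∷ 25 ∷ []) ∷ (22 ∷ 23 ∷ 26 ∷ []) ∷ (0 ∷ 24 ∷ 27 ∷ []) ∷ [])
  ∷ ((1 ∷ 0 ∷ 30 ∷ []) ∷ (0 ∷ 26 ∷ 29 ∷ []) ∷ (26 ∷ 25 ∷ 24 ∷ []) ∷ (21 ∷ 22 ∷ 23 ∷ []) ∷ (20 ∷ 13 ∷ 0 ∷ []) ∷ (19 ∷ 16 ∷ 15 ∷ []) ∷ (18 ∷ 17 ∷ 0 ∷ []) ∷ [])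
  ∷ ((29 ∷ 28 ∷ 29 ∷ []) ∷ (28 ∷ 27 ∷ 28 ∷ []) ∷ (27 ∷ 0 ∷ 15 ∷ []) ∷ (0 ∷ 1 ∷ 14 ∷ []) ∷ (11 ∷ 12 ∷ 13 ∷ []) ∷ (0 ∷ 13 ∷ 14 ∷ []) ∷ (17 ∷ 16 ∷ 15 ∷ []) ∷ [])
  ∷ ((30 ∷ 1 ∷ 0 ∷ []) ∷ (29 ∷ 0 ∷ 1 ∷ []) ∷ (28 ∷ 1 ∷ 2 ∷ []) ∷ (11 ∷ 0 ∷ 1 ∷ []) ∷ (10 ∷ 7 ∷ 0 ∷ []) ∷ (9 ∷ 8 ∷ 9 ∷ []) ∷ (0 ∷ 1 ∷ 0 ∷ []) ∷ [])
  ∷ ((31 ∷ 0 ∷ 1 ∷ []) ∷ (30 ∷ 1 ∷ 0 ∷ []) ∷ (29 ∷ 4 ∷ 3 ∷ []) ∷ (12 ∷ 5 ∷ 0 ∷ []) ∷ (0 ∷ 6 ∷ 7 ∷ []) ∷ (10 ∷ 0 ∷ 10 ∷ []) ∷ (11 ∷ 0 ∷ 11 ∷ []) ∷ [])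
  ∷ [])

rankTable 5 7 4 = fromTable
  ( ((0 ∷ 1 ∷ 24 ∷ 25 ∷ []) ∷ (1 ∷ 0 ∷ 13 ∷ 20 ∷ []) ∷ (0 ∷ 1 ∷ 12 ∷ 17 ∷ []) ∷ (11 ∷ 10 ∷ 11 ∷ 16 ∷ []) ∷ (0 ∷ 9 ∷ 10 ∷ 0 ∷ []) ∷ (25 ∷ 0 ∷ 11 ∷ 12 ∷ []) ∷ (26 ∷ 13 ∷ 12 ∷ 0 ∷ []) ∷ [])
  ∷ ((1 ∷ 0 ∷ 23 ∷ 24 ∷ []) ∷ (2 ∷ 1 ∷ 2 ∷ 19 ∷ []) ∷ (3 ∷ 0 ∷ 1 ∷ 0 ∷ []) ∷ (12 ∷ 9 ∷ 0 ∷ 15 ∷ []) ∷ (13 ∷ 8 ∷ 0 ∷ 14 ∷ []) ∷ (24 ∷ 1 ∷ 4 ∷ 13 ∷ []) ∷ (25 ∷ 0 ∷ 5 ∷ 6 ∷ []) ∷ [])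
  ∷ ((0 ∷ 15 ∷ 22 ∷ 23 ∷ []) ∷ (15 ∷ 14 ∷ 0 ∷ 18 ∷ []) ∷ (16 ∷ 13 ∷ 12 ∷ 17 ∷ []) ∷ (17 ∷ 10 ∷ 11 ∷ 16 ∷ []) ∷ (18 ∷ 7 ∷ 6 ∷ 15 ∷ []) ∷ (23 ∷ 0 ∷ 3 ∷ 14 ∷ []) ∷ (24 ∷ 1 ∷ 2 ∷ 0 ∷ []) ∷ [])
  ∷ ((21 ∷ 18 ∷ 21 ∷ 22 ∷ []) ∷ (20 ∷ 17 ∷ 16 ∷ 0 ∷ []) ∷ (19 ∷ 14 ∷ 15 ∷ 18 ∷ []) ∷ (18 ∷ 0 ∷ 12 ∷ 19 ∷ []) ∷ (19 ∷ 4 ∷ 5 ∷ 20 ∷ []) ∷ (22 ∷ 1 ∷ 0 ∷ 21 ∷ []) ∷ (23 ∷ 0 ∷ 1 ∷ 22 ∷ []) ∷ [])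
  ∷ ((22 ∷ 0 ∷ 20 ∷ 0 ∷ []) ∷ (21 ∷ 18 ∷ 19 ∷ 20 ∷ []) ∷ (20 ∷ 0 ∷ 16 ∷ 21 ∷ []) ∷ (0 ∷ 1 ∷ 13 ∷ 22 ∷ []) ∷ (20 ∷ 3 ∷ 0 ∷ 23 ∷ []) ∷ (21 ∷ 2 ∷ 1 ∷ 24 ∷ []) ∷ (0 ∷ 1 ∷ 0 ∷ 25 ∷ []) ∷ [])
  ∷ [])

rankTable 5 7 5 = fromTable
  ( ((25 ∷ 24 ∷ 21 ∷ 0 ∷ 21 ∷ []) ∷ (22 ∷ 21 ∷ 20 ∷ 19 ∷ 20 ∷ []) ∷ (17 ∷ 16 ∷ 0 ∷ 18 ∷ 19 ∷ []) ∷ (16 ∷ 15 ∷ 12 ∷ 11 ∷ 0 ∷ []) ∷ (15 ∷ 14 ∷ 13 ∷ 0 ∷ 13 ∷ []) ∷ (0 ∷ 1 ∷ 14 ∷ 15 ∷ 16 ∷ []) ∷ (1 ∷ 0 ∷ 15 ∷ 16 ∷ 17 ∷ []) ∷ [])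
  ∷ ((24 ∷ 23 ∷ 0 ∷ 19 ∷ 20 ∷ []) ∷ (13 ∷ 12 ∷ 9 ∷ 18 ∷ 19 ∷ []) ∷ (10 ∷ 9 ∷ 8 ∷ 17 ∷ 18 ∷ []) ∷ (9 ∷ 6 ∷ 0 ∷ 10 ∷ 11 ∷ []) ∷ (6 ∷ 5 ∷ 3 ∷ 4 ∷ 12 ∷ []) ∷ (1 ∷ 0 ∷ 2 ∷ 0 ∷ 13 ∷ []) ∷ (0 ∷ 1 ∷ 3 ∷ 11 ∷ 14 ∷ []) ∷ [])
  ∷ ((0 ∷ 22 ∷ 21 ∷ 20 ∷ 0 ∷ []) ∷ (10 ∷ 11 ∷ 0 ∷ 17 ∷ 18 ∷ []) ∷ (9 ∷ 0 ∷ 7 ∷ 16 ∷ 17 ∷ []) ∷ (8 ∷ 5 ∷ 6 ∷ 9 ∷ 10 ∷ []) ∷ (0 ∷ 4 ∷ 0 ∷ 5 ∷ 0 ∷ []) ∷ (2 ∷ 3 ∷ 1 ∷ 6 ∷ 10 ∷ []) ∷ (5 ∷ 4 ∷ 0 ∷ 10 ∷ 11 ∷ []) ∷ [])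
  ∷ ((1 ∷ 23 ∷ 24 ∷ 25 ∷ 26 ∷ []) ∷ (0 ∷ 12 ∷ 13 ∷ 14 ∷ 0 ∷ []) ∷ (8 ∷ 1 ∷ 8 ∷ 15 ∷ 16 ∷ []) ∷ (7 ∷ 0 ∷ 7 ∷ 8 ∷ 0 ∷ []) ∷ (6 ∷ 5 ∷ 6 ∷ 7 ∷ 1 ∷ []) ∷ (0 ∷ 4 ∷ 0 ∷ 8 ∷ 9 ∷ []) ∷ (6 ∷ 5 ∷ 1 ∷ 9 ∷ 0 ∷ []) ∷ [])
  ∷ ((0 ∷ 24 ∷ 25 ∷ 26 ∷ 27 ∷ []) ∷ (10 ∷ 13 ∷ 14 ∷ 0 ∷ 20 ∷ []) ∷ (9 ∷ 0 ∷ 15 ∷ 16 ∷ 19 ∷ []) ∷ (0 ∷ 1 ∷ 16 ∷ 17 ∷ 18 ∷ []) ∷ (21 ∷ 20 ∷ 19 ∷ 18 ∷ 0 ∷ []) ∷ (22 ∷ 21 ∷ 20 ∷ 21 ∷ 22 ∷ []) ∷ (23 ∷ 22 ∷ 0 ∷ 22 ∷ 23 ∷ []) ∷ [])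
  ∷ [])

rankTable 5 7 6 = fromTable
  ( ((0 ∷ 32 ∷ 33 ∷ 34 ∷ 35 ∷ 36 ∷ []) ∷ (30 ∷ 31 ∷ 32 ∷ 33 ∷ 34 ∷ 35 ∷ []) ∷ (29 ∷ 28 ∷ 27 ∷ 26 ∷ 0 ∷ 28 ∷ []) ∷ (28 ∷ 27 ∷ 26 ∷ 25 ∷ 24 ∷ 27 ∷ []) ∷ (9 ∷ 0 ∷ 9 ∷ 16 ∷ 23 ∷ 26 ∷ []) ∷ (0 ∷ 1 ∷ 0 ∷ 15 ∷ 22 ∷ 0 ∷ []) ∷ (3 ∷ 2 ∷ 1 ∷ 0 ∷ 23 ∷ 24 ∷ []) ∷ [])
  ∷ ((24 ∷ 23 ∷ 22 ∷ 21 ∷ 0 ∷ 29 ∷ []) ∷ (23 ∷ 22 ∷ 21 ∷ 20 ∷ 19 ∷ 28 ∷ []) ∷ (12 ∷ 11 ∷ 0 ∷ 17 ∷ 18 ∷ 27 ∷ []) ∷ (11 ∷ 10 ∷ 9 ∷ 16 ∷ 19 ∷ 26 ∷ []) ∷ (8 ∷ 7 ∷ 8 ∷ 15 ∷ 20 ∷ 25 ∷ []) ∷ (5 ∷ 4 ∷ 3 ∷ 14 ∷ 21 ∷ 22 ∷ []) ∷ (0 ∷ 1 ∷ 0 ∷ 1 ∷ 22 ∷ 0 ∷ []) ∷ [])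
  ∷ ((25 ∷ 20 ∷ 19 ∷ 18 ∷ 1 ∷ 0 ∷ []) ∷ (3 ∷ 0 ∷ 16 ∷ 17 ∷ 18 ∷ 27 ∷ []) ∷ (0 ∷ 1 ∷ 9 ∷ 10 ∷ 0 ∷ 26 ∷ []) ∷ (1 ∷ 7 ∷ 8 ∷ 0 ∷ 14 ∷ 25 ∷ []) ∷ (0 ∷ 6 ∷ 0 ∷ 12 ∷ 15 ∷ 24 ∷ []) ∷ (6 ∷ 5 ∷ 2 ∷ 13 ∷ 16 ∷ 23 ∷ []) ∷ (7 ∷ 0 ∷ 1 ∷ 0 ∷ 23 ∷ 24 ∷ []) ∷ [])
  ∷ ((26 ∷ 0 ∷ 16 ∷ 17 ∷ 0 ∷ 29 ∷ []) ∷ (2 ∷ 1 ∷ 15 ∷ 16 ∷ 17 ∷ 28 ∷ []) ∷ (1 ∷ 0 ∷ 10 ∷ 11 ∷ 12 ∷ 0 ∷ []) ∷ (0 ∷ 8 ∷ 9 ∷ 10 ∷ 13 ∷ 16 ∷ []) ∷ (12 ∷ 11 ∷ 10 ∷ 11 ∷ 14 ∷ 15 ∷ []) ∷ (13 ∷ 12 ∷ 0 ∷ 14 ∷ 15 ∷ 0 ∷ []) ∷ (30 ∷ 29 ∷ 28 ∷ 27 ∷ 26 ∷ 25 ∷ []) ∷ [])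
  ∷ ((27 ∷ 16 ∷ 0 ∷ 18 ∷ 19 ∷ 30 ∷ []) ∷ (0 ∷ 15 ∷ 14 ∷ 0 ∷ 18 ∷ 29 ∷ []) ∷ (17 ∷ 16 ∷ 13 ∷ 12 ∷ 13 ∷ 18 ∷ []) ∷ (18 ∷ 17 ∷ 0 ∷ 1 ∷ 0 ∷ 17 ∷ []) ∷ (19 ∷ 18 ∷ 11 ∷ 0 ∷ 1 ∷ 0 ∷ []) ∷ (20 ∷ 19 ∷ 18 ∷ 17 ∷ 16 ∷ 1 ∷ []) ∷ (31 ∷ 30 ∷ 29 ∷ 28 ∷ 27 ∷ 0 ∷ []) ∷ [])
  ∷ [])

rankTable 5 7 7 = fromTable
  ( ((76 ∷ 75 ∷ 74 ∷ 73 ∷ 60 ∷ 59 ∷ 0 ∷ []) ∷ (9 ∷ 0 ∷ 1 ∷ 24 ∷ 0 ∷ 58 ∷ 63 ∷ []) ∷ (8 ∷ 7 ∷ 0 ∷ 23 ∷ 28 ∷ 55 ∷ 64 ∷ []) ∷ (0 ∷ 8 ∷ 9 ∷ 22 ∷ 29 ∷ 54 ∷ 65 ∷ []) ∷ (12 ∷ 11 ∷ 10 ∷ 0 ∷ 36 ∷ 53 ∷ 66 ∷ []) ∷ (41 ∷ 40 ∷ 39 ∷ 40 ∷ 41 ∷ 42 ∷ 67 ∷ []) ∷ (52 ∷ 51 ∷ 0 ∷ 43 ∷ 42 ∷ 0 ∷ 68 ∷ []) ∷ [])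
  ∷ ((0 ∷ 74 ∷ 73 ∷ 72 ∷ 0 ∷ 58 ∷ 63 ∷ []) ∷ (2 ∷ 1 ∷ 0 ∷ 25 ∷ 26 ∷ 57 ∷ 62 ∷ []) ∷ (0 ∷ 6 ∷ 7 ∷ 22 ∷ 27 ∷ 0 ∷ 61 ∷ []) ∷ (1 ∷ 7 ∷ 8 ∷ 21 ∷ 28 ∷ 53 ∷ 58 ∷ []) ∷ (0 ∷ 8 ∷ 0 ∷ 20 ∷ 35 ∷ 52 ∷ 53 ∷ []) ∷ (40 ∷ 39 ∷ 38 ∷ 37 ∷ 36 ∷ 37 ∷ 0 ∷ []) ∷ (51 ∷ 50 ∷ 45 ∷ 44 ∷ 0 ∷ 1 ∷ 53 ∷ []) ∷ [])
  ∷ ((76 ∷ 75 ∷ 72 ∷ 71 ∷ 30 ∷ 0 ∷ 64 ∷ []) ∷ (3 ∷ 0 ∷ 9 ∷ 26 ∷ 29 ∷ 56 ∷ 61 ∷ []) ∷ (4 ∷ 5 ∷ 8 ∷ 0 ∷ 28 ∷ 55 ∷ 60 ∷ []) ∷ (2 ∷ 0 ∷ 9 ∷ 10 ∷ 0 ∷ 54 ∷ 57 ∷ []) ∷ (12 ∷ 11 ∷ 10 ∷ 19 ∷ 34 ∷ 51 ∷ 52 ∷ []) ∷ (15 ∷ 12 ∷ 0 ∷ 20 ∷ 35 ∷ 38 ∷ 51 ∷ []) ∷ (50 ∷ 49 ∷ 46 ∷ 45 ∷ 36 ∷ 0 ∷ 52 ∷ []) ∷ [])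
  ∷ ((77 ∷ 76 ∷ 71 ∷ 70 ∷ 67 ∷ 66 ∷ 65 ∷ []) ∷ (0 ∷ 17 ∷ 18 ∷ 27 ∷ 30 ∷ 57 ∷ 60 ∷ []) ∷ (5 ∷ 16 ∷ 17 ∷ 18 ∷ 29 ∷ 56 ∷ 59 ∷ []) ∷ (0 ∷ 15 ∷ 16 ∷ 17 ∷ 30 ∷ 55 ∷ 56 ∷ []) ∷ (13 ∷ 14 ∷ 15 ∷ 18 ∷ 33 ∷ 50 ∷ 0 ∷ []) ∷ (14 ∷ 0 ∷ 1 ∷ 0 ∷ 34 ∷ 49 ∷ 50 ∷ []) ∷ (0 ∷ 48 ∷ 47 ∷ 46 ∷ 47 ∷ 48 ∷ 0 ∷ []) ∷ [])
  ∷ ((78 ∷ 77 ∷ 0 ∷ 69 ∷ 68 ∷ 67 ∷ 0 ∷ []) ∷ (69 ∷ 68 ∷ 61 ∷ 60 ∷ 59 ∷ 58 ∷ 0 ∷ []) ∷ (68 ∷ 67 ∷ 62 ∷ 19 ∷ 0 ∷ 57 ∷ 58 ∷ []) ∷ (67 ∷ 66 ∷ 63 ∷ 0 ∷ 31 ∷ 56 ∷ 0 ∷ []) ∷ (0 ∷ 65 ∷ 64 ∷ 19 ∷ 32 ∷ 57 ∷ 58 ∷ []) ∷ (67 ∷ 66 ∷ 65 ∷ 1 ∷ 0 ∷ 58 ∷ 59 ∷ []) ∷ (68 ∷ 67 ∷ 66 ∷ 0 ∷ 48 ∷ 59 ∷ 60 ∷ []) ∷ [])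
  ∷ [])

-- junk value: only the 72 grids above are ever consulted
rankTable _ _ _ = λ _ → 0

rankTable-optimal : (i : Fin 2) (j k : Fin 6) →
  OptimalRanking (rankTable (4 + toℕ i) (2 + toℕ j) (2 + toℕ k))
rankTable-optimal = toWitness {a? = all? λ i → all? λ j → all? λ k → optimalRanking? _} _

lemma4p1 : (a b c : ℕ) → (a ≡ 4 ⊎ a ≡ 5) → 2 ≤ b → b ≤ 7 → 2 ≤ c → c ≤ 7 → Optimal a b c
lemma4p1 a b c a∈4,5 2≤b b≤7 2≤c c≤7
  with j , refl ← interval-offset 2≤b b≤7 | k , refl ← interval-offset 2≤c c≤7 | a∈4,5
... | inj₁ refl = optimalRanking⇒optimal (rankTable-optimal zero j k)
... | inj₂ refl = optimalRanking⇒optimal (rankTable-optimal (suc zero) j k)
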